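{- Let $k\ge 2$ be an integer and for an integer $m\ge 2$ let $C_m=m\,(m-1)^{\frac1m-1}$. Then every finite simple graph $G$ with maximum degree $\Delta\ge 1$ has a star-$k$ coloring with at most $C_{2k-2}\,k^{\frac{1}{2k-2}}\,\Delta^{\frac{2k-1}{2k-2}}+\Delta$ colors.
   Context: A star-$k$ coloring of a graph $G$ is a proper vertex-coloring of $G$ (adjacent vertices get different colors) such that every path of $G$ on $2k$ vertices receives at least three distinct colors. -}

module Defs where

open import Data.Nat using (ℕ; zero; suc; _+_; _*_; _∸_; _^_; _≤_)
open import Data.Fin using (Fin; toℕ)
open import Data.Bool using (Bool; true; false)
open import Data.List using (length; filterᵇ; allFin)
open import Data.Product using (Σ; ∃; _×_; _,_)
open import Data.Sum using (_⊎_)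
open import Relation.Binary.PropositionalEquality using (_≡_)
open import Relation.Nullary using (¬_)
open import Function.Definitions using (Injective)

record Graph (n : ℕ) : Set where
  field
    adj   : Fin n → Fin n → Bool
    sym   : ∀ u v → adj u v ≡ adj v u
    irrefl : ∀ v → adj v v ≡ false
open Graph public

degree : ∀ {n} → Graph n → Fin n → ℕ
degree G v = length (filterᵇ (adj G v) (allFin _))

MaxDegree : ∀ {n} → Graph n → ℕ → Set
MaxDegree G Δ = (∀ v → degree G v ≤ Δ) × ∃ λ v → degree G v ≡ Δ

IsPath : ∀ {n} → Graph n → (L : ℕ) → (Fin L → Fin n) → Set
IsPath G L p = Injective _≡_ _≡_ p
             × (∀ (i j : Fin L) → toℕ j ≡ suc (toℕ i) → adj G (p i) (p j) ≡ true)

Proper : ∀ {n c} → Graph n → (Fin n → Fin c) → Set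
Proper G f = ∀ u v → adj G u v ≡ true → ¬ (f u ≡ f v)

ThreeColours : ∀ {n c L} → (Fin n → Fin c) → (Fin L → Fin n) → Set
ThreeColours {L = L} f p =
  Σ (Fin L) λ i → Σ (Fin L) λ j → Σ (Fin L) λ l →
    ¬ (f (p i) ≡ f (p j)) × ¬ (f (p i) ≡ f (p l)) × ¬ (f (p j) ≡ f (p l))

StarKColoring : ∀ {n c} → ℕ → Graph n → (Fin n → Fin c) → Set
StarKColoring {n} k G f =
  Proper G f × (∀ (p : Fin (2 * k) → Fin n) → IsPath G (2 * k) p → ThreeColours f p)

-- The real bound: c ≤ C_m k^{1/m} Δ^{(m+1)/m} + Δ, with m = 2k-2 and
-- C_m = m (m-1)^{1/m - 1}.  Over ℕ (m ≥ 2, Δ ≥ 1) this is equivalent to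
--   c ≤ Δ  or  (c - Δ)^m (m-1)^(m-1) ≤ m^m k Δ^(m+1).
WithinBound : ℕ → ℕ → ℕ → Set
WithinBound k Δ c =
  c ≤ Δ ⊎ ((c ∸ Δ) ^ m * (m ∸ 1) ^ (m ∸ 1) ≤ m ^ m * k * Δ ^ (m + 1))
  where
    m : ℕ
    m = 2 * k ∸ 2

{-# OPTIONS --safe #-}
module Submission where

-- Counting argument (in the style of Rosenfeld). Let m = 2k - 2, use N = Δ + x colours and call a
-- partial colouring good if it is proper and leaves no bicoloured path on 2k vertices. Write #Good(S)
-- for the number of good colourings with domain S. For v ∉ S, each of the N colours of v extends a good
-- colouring of S to a good one, or is blocked by one of the ≤ Δ neighbours of v, or completes a
-- bicoloured path through v. Such a path is fixed by at most k Δ (Δ-1)^m choices of its two arms at v,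
-- and then its colours are determined by those of the two vertices next to v on the longer arm, so the
-- bad cases are counted by #Good on S minus the m - 1 remaining path vertices. By strong induction on |S|,
-- #Good(S ∪ {v}) ≥ (x (m-1)/m) #Good(S) whenever x^m (m-1)^(m-1) ≥ k Δ (Δ-1)^m m^m, and taking the
-- largest x with x^m (m-1)^(m-1) ≤ m^m k Δ^(m+1) gives #Good(V) ≥ (x (m-1)/m)^n > 0.

open import Defs hiding (sym)
open import Data.Bool using (Bool; true; false; not; T)
import Data.Bool as Bool
open import Data.Empty using (⊥; ⊥-elim)
open import Data.Fin using (Fin; zero; suc; toℕ; _≟_)
import Data.Fin.Properties as Fin
open import Data.List using (List; []; _∷_; length; _++_; reverse; [_]; _∷ʳ_; map; filter; filterᵇ; allFin; tabulate)
open import Data.List.Membership.Propositional using (_∈_; _∉_; lose)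
import Data.List.Membership.DecPropositional as DecMembership
open import Data.List.Membership.Propositional.Properties using (∈-filter⁺; ∈-filter⁻; ∈-allFin; ∈-tabulate⁺; ∈-tabulate⁻; ∈-∃++; ∈-++⁺ˡ; ∈-++⁺ʳ)
open import Data.List.Properties using (++-assoc; reverse-++; unfold-reverse; reverse-involutive; length-tabulate; length-++; length-reverse; map-++; filter-notAll)
open import Data.List.Relation.Unary.All using (All; []; _∷_)
import Data.List.Relation.Unary.All as All
import Data.List.Relation.Unary.All.Properties as All
open import Data.List.Relation.Unary.Any using (Any; here; there)
import Data.List.Relation.Unary.Any as Any
open import Data.Maybe using (Maybe; just; nothing)
import Data.Maybe.Properties as Maybe
open import Data.Nat using (ℕ; zero; suc; _+_; _*_; _∸_; _^_; _≤_; _<_; z≤n; s≤s; _≤?_; _<?_; NonZero; >-nonZero; pred)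
open import Data.Nat.Properties hiding (_≟_)
import Data.Nat.Properties as ℕ
open import Data.Nat.Tactic.RingSolver using (solve-∀)
open import Data.Product using (Σ; ∃; _×_; _,_; proj₁; proj₂)
open import Data.Sum using (_⊎_; inj₁; inj₂)
import Data.Sum
open import Data.Unit using (⊤; tt)
open import Data.Vec using (Vec; []; _∷_; lookup; _[_]≔_; replicate)
open import Data.Vec.Properties using (lookup∘update; lookup∘update′; lookup-replicate; []≔-idempotent; []≔-lookup)
open import Function using (_∘_; flip)
open import Relation.Binary using (tri<; tri≈; tri>)
open import Relation.Binary.PropositionalEquality using (_≡_; _≢_; refl; sym; trans; cong; cong₂; subst; module ≡-Reasoning)
open import Relation.Nullary using (Dec; yes; no; ¬_; ¬?)
open import Relation.Nullary.Decidable using (_×-dec_; _→-dec_; T?)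

module Sums where

  𝟙 : ∀ {ℓ} {P : Set ℓ} → Dec P → ℕ
  𝟙 (yes _) = 1
  𝟙 (no _)  = 0

  𝟙-yes : ∀ {ℓ} {P : Set ℓ} (d : Dec P) → P → 𝟙 d ≡ 1
  𝟙-yes (yes _) _  = refl
  𝟙-yes (no ¬p) p = ⊥-elim (¬p p)

  𝟙-no : ∀ {ℓ} {P : Set ℓ} (d : Dec P) → ¬ P → 𝟙 d ≡ 0
  𝟙-no (yes p) ¬p = ⊥-elim (¬p p)
  𝟙-no (no _)  _  = refl

  𝟙-mono : ∀ {ℓ ℓ′} {P : Set ℓ} {Q : Set ℓ′} (d : Dec P) (e : Dec Q) → (P → Q) → 𝟙 d ≤ 𝟙 e
  𝟙-mono (yes p) e       f = ≤-reflexive (sym (𝟙-yes e (f p)))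
  𝟙-mono (no _)  _       _ = z≤n

  𝟙-witness : ∀ {ℓ} {P : Set ℓ} (d : Dec P) → 1 ≤ 𝟙 d → P
  𝟙-witness (yes p) _ = p

  record Summation (I : Set) : Set₁ where
    field
      ∑      : (I → ℕ) → ℕ
      ∑-cong : ∀ {f g} → (∀ i → f i ≡ g i) → ∑ f ≡ ∑ g
      ∑-+    : ∀ f g → ∑ (λ i → f i + g i) ≡ ∑ f + ∑ g
      ∑-0    : ∑ (λ _ → 0) ≡ 0
      ∑-mono : ∀ {f g} → (∀ i → f i ≤ g i) → ∑ f ≤ ∑ g
  open Summation public

  +-interchange : ∀ a b c d → a + b + (c + d) ≡ a + c + (b + d)
  +-interchange = solve-∀

  ∑Fin : ∀ N → (Fin N → ℕ) → ℕ
  ∑Fin zero    f = 0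
  ∑Fin (suc N) f = f zero + ∑Fin N (f ∘ suc)

  ∑List : ∀ {A : Set} → List A → (A → ℕ) → ℕ
  ∑List []       f = 0
  ∑List (x ∷ xs) f = f x + ∑List xs f

  ∑Fin-cong : ∀ N {f g : Fin N → ℕ} → (∀ i → f i ≡ g i) → ∑Fin N f ≡ ∑Fin N g
  ∑Fin-cong zero    e = refl
  ∑Fin-cong (suc N) e = cong₂ _+_ (e zero) (∑Fin-cong N (e ∘ suc))

  ∑Fin-+ : ∀ N (f g : Fin N → ℕ) → ∑Fin N (λ i → f i + g i) ≡ ∑Fin N f + ∑Fin N g
  ∑Fin-+ zero    f g = refl
  ∑Fin-+ (suc N) f g = trans (cong (f zero + g zero +_) (∑Fin-+ N (f ∘ suc) (g ∘ suc)))
                             (+-interchange (f zero) (g zero) _ _)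

  ∑Fin-0 : ∀ N → ∑Fin N (λ _ → 0) ≡ 0
  ∑Fin-0 zero    = refl
  ∑Fin-0 (suc N) = ∑Fin-0 N

  ∑Fin-mono : ∀ N {f g : Fin N → ℕ} → (∀ i → f i ≤ g i) → ∑Fin N f ≤ ∑Fin N g
  ∑Fin-mono zero    e = z≤n
  ∑Fin-mono (suc N) e = +-mono-≤ (e zero) (∑Fin-mono N (e ∘ suc))

  ∑Fin-summation : ∀ N → Summation (Fin N)
  ∑Fin-summation N = record
    { ∑ = ∑Fin N ; ∑-cong = ∑Fin-cong N ; ∑-+ = ∑Fin-+ N ; ∑-0 = ∑Fin-0 N ; ∑-mono = ∑Fin-mono N }

  ∑Fin-const : ∀ N a → ∑Fin N (λ _ → a) ≡ N * a
  ∑Fin-const zero    a = refl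
  ∑Fin-const (suc N) a = cong (a +_) (∑Fin-const N a)

  ∑Fin-≥ : ∀ N (f : Fin N → ℕ) i → f i ≤ ∑Fin N f
  ∑Fin-≥ (suc N) f zero    = m≤m+n _ _
  ∑Fin-≥ (suc N) f (suc i) = ≤-trans (∑Fin-≥ N (f ∘ suc) i) (m≤n+m _ (f zero))

  ∑Fin-≤-* : ∀ N {f : Fin N → ℕ} {M} → (∀ i → f i ≤ M) → ∑Fin N f ≤ N * M
  ∑Fin-≤-* N {M = M} e = ≤-trans (∑Fin-mono N e) (≤-reflexive (∑Fin-const N M))

  ∑Fin-positive : ∀ N (f : Fin N → ℕ) → 1 ≤ ∑Fin N f → ∃ λ i → 1 ≤ f i
  ∑Fin-positive (suc N) f p with f zero in e
  ... | suc _ = zero , ≤-trans (s≤s z≤n) (≤-reflexive (sym e))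
  ... | zero with ∑Fin-positive N (f ∘ suc) p
  ...   | i , q = suc i , q

  ∑Fin-∑ : ∀ {I} (X : Summation I) N (H : Fin N → I → ℕ) →
    ∑Fin N (λ c → ∑ X (H c)) ≡ ∑ X (λ i → ∑Fin N (λ c → H c i))
  ∑Fin-∑ X zero    H = sym (∑-0 X)
  ∑Fin-∑ X (suc N) H = trans (cong (∑ X (H zero) +_) (∑Fin-∑ X N (H ∘ suc)))
                             (sym (∑-+ X (H zero) _))

  *-∑ : ∀ {I} (X : Summation I) a (f : I → ℕ) → a * ∑ X f ≡ ∑ X (λ i → a * f i)
  *-∑ X a f = trans (sym (∑Fin-const a (∑ X f)))
                    (trans (∑Fin-∑ X a (λ _ → f)) (∑-cong X (λ i → ∑Fin-const a (f i))))

  module _ {A : Set} where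
    ∑List-cong : ∀ (xs : List A) {f g} → (∀ i → f i ≡ g i) → ∑List xs f ≡ ∑List xs g
    ∑List-cong []       e = refl
    ∑List-cong (x ∷ xs) e = cong₂ _+_ (e x) (∑List-cong xs e)

    ∑List-mono : ∀ (xs : List A) {f g} → (∀ i → f i ≤ g i) → ∑List xs f ≤ ∑List xs g
    ∑List-mono []       e = z≤n
    ∑List-mono (x ∷ xs) e = +-mono-≤ (e x) (∑List-mono xs e)

    ∑List-≤-* : ∀ (xs : List A) {f} {M} → (∀ x → x ∈ xs → f x ≤ M) → ∑List xs f ≤ length xs * M
    ∑List-≤-* []       e = z≤n
    ∑List-≤-* (x ∷ xs) e = +-mono-≤ (e x (here refl)) (∑List-≤-* xs (λ y m → e y (there m)))

    ∑List-≥ : ∀ {xs : List A} {x} (f : A → ℕ) → x ∈ xs → f x ≤ ∑List xs f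
    ∑List-≥ f (here refl) = m≤m+n _ _
    ∑List-≥ {y ∷ xs} f (there p) = ≤-trans (∑List-≥ f p) (m≤n+m _ (f y))

    ∑List-∑ : ∀ {I} (X : Summation I) (xs : List A) (H : A → I → ℕ) →
      ∑List xs (λ c → ∑ X (H c)) ≡ ∑ X (λ i → ∑List xs (λ c → H c i))
    ∑List-∑ X []       H = sym (∑-0 X)
    ∑List-∑ X (x ∷ xs) H = trans (cong (∑ X (H x) +_) (∑List-∑ X xs H))
                                 (sym (∑-+ X (H x) _))

  ∑Fin-𝟙≤1 : ∀ N {P : Fin N → Set} (P? : ∀ c → Dec (P c)) → (∀ c c′ → P c → P c′ → c ≡ c′) →
    ∑Fin N (𝟙 ∘ P?) ≤ 1
  ∑Fin-𝟙≤1 zero    P? unique = z≤n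
  ∑Fin-𝟙≤1 (suc N) P? unique with P? zero
  ... | yes p₀ = s≤s (≤-reflexive (trans (∑Fin-cong N (λ c → 𝟙-no (P? (suc c)) (Fin.0≢1+n ∘ unique _ _ p₀))) (∑Fin-0 N)))
  ... | no _   = ∑Fin-𝟙≤1 N (P? ∘ suc) (λ c c′ p p′ → Fin.suc-injective (unique _ _ p p′))

  ∑Fin-𝟙≤1-just : ∀ N (m : Maybe (Fin N)) {P : Fin N → Set} (P? : ∀ c → Dec (P c)) → (∀ c → P c → m ≡ just c) →
    ∑Fin N (𝟙 ∘ P?) ≤ 1
  ∑Fin-𝟙≤1-just N m P? determined =
    ∑Fin-𝟙≤1 N P? (λ c c′ p p′ → Maybe.just-injective (trans (sym (determined c p)) (determined c′ p′)))

  union-bound : ∀ {A : Set} {P : A → Set} (P? : ∀ x → Dec (P x)) xs (d : Dec (Any P xs)) → 𝟙 d ≤ ∑List xs (𝟙 ∘ P?)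
  union-bound P? xs       (no _)           = z≤n
  union-bound P? (x ∷ xs) (yes (here p))   = ≤-trans (≤-reflexive (sym (𝟙-yes (P? x) p))) (m≤m+n _ _)
  union-bound P? (x ∷ xs) (yes (there ps)) = ≤-trans (union-bound P? xs (yes ps)) (m≤n+m _ _)

module Windows {A : Set} where

  Chain : (A → A → Set) → List A → Set
  Chain R []           = ⊤
  Chain R (x ∷ [])     = ⊤
  Chain R (x ∷ y ∷ xs) = R x y × Chain R (y ∷ xs)

  Chain₃ : (A → A → A → Set) → List A → Set
  Chain₃ R []               = ⊤
  Chain₃ R (x ∷ [])         = ⊤
  Chain₃ R (x ∷ y ∷ [])     = ⊤
  Chain₃ R (x ∷ y ∷ z ∷ xs) = R x y z × Chain₃ R (y ∷ z ∷ xs)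

  Chain? : ∀ {R} → (∀ x y → Dec (R x y)) → ∀ xs → Dec (Chain R xs)
  Chain? R? []           = yes tt
  Chain? R? (x ∷ [])     = yes tt
  Chain? R? (x ∷ y ∷ xs) = R? x y ×-dec Chain? R? (y ∷ xs)

  Chain₃? : ∀ {R} → (∀ x y z → Dec (R x y z)) → ∀ xs → Dec (Chain₃ R xs)
  Chain₃? R? []               = yes tt
  Chain₃? R? (x ∷ [])         = yes tt
  Chain₃? R? (x ∷ y ∷ [])     = yes tt
  Chain₃? R? (x ∷ y ∷ z ∷ xs) = R? x y z ×-dec Chain₃? R? (y ∷ z ∷ xs)

  Chain-map : ∀ {R R′} → (∀ {x y} → R x y → R′ x y) → ∀ xs → Chain R xs → Chain R′ xs
  Chain-map f []           _       = tt
  Chain-map f (x ∷ [])     _       = tt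
  Chain-map f (x ∷ y ∷ xs) (r , c) = f r , Chain-map f (y ∷ xs) c

  Chain₃-map : ∀ {R R′} → (∀ {x y z} → R x y z → R′ x y z) → ∀ xs → Chain₃ R xs → Chain₃ R′ xs
  Chain₃-map f []               _       = tt
  Chain₃-map f (x ∷ [])         _       = tt
  Chain₃-map f (x ∷ y ∷ [])     _       = tt
  Chain₃-map f (x ∷ y ∷ z ∷ xs) (r , c) = f r , Chain₃-map f (y ∷ z ∷ xs) c

  Chain-tail : ∀ {R} x xs → Chain R (x ∷ xs) → Chain R xs
  Chain-tail x []       _ = tt
  Chain-tail x (y ∷ xs) c = proj₂ c

  Chain₃-tail : ∀ {R} x xs → Chain₃ R (x ∷ xs) → Chain₃ R xs
  Chain₃-tail x []           _ = tt
  Chain₃-tail x (y ∷ [])     _ = tt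
  Chain₃-tail x (y ∷ z ∷ xs) c = proj₂ c

  Chain-suffix : ∀ {R} xs ys → Chain R (xs ++ ys) → Chain R ys
  Chain-suffix []       ys c = c
  Chain-suffix (x ∷ xs) ys c = Chain-suffix xs ys (Chain-tail x _ c)

  Chain₃-suffix : ∀ {R} xs ys → Chain₃ R (xs ++ ys) → Chain₃ R ys
  Chain₃-suffix []       ys c = c
  Chain₃-suffix (x ∷ xs) ys c = Chain₃-suffix xs ys (Chain₃-tail x _ c)

  Chain-at : ∀ {R} xs x y ys → Chain R (xs ++ x ∷ y ∷ ys) → R x y
  Chain-at []       x y ys c = proj₁ c
  Chain-at (z ∷ xs) x y ys c = Chain-at xs x y ys (Chain-tail z _ c)

  Chain₃-at : ∀ {R} xs x y z ys → Chain₃ R (xs ++ x ∷ y ∷ z ∷ ys) → R x y z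
  Chain₃-at []       x y z ys c = proj₁ c
  Chain₃-at (u ∷ xs) x y z ys c = Chain₃-at xs x y z ys (Chain₃-tail u _ c)

  Chain-intro : ∀ {R} zs → (∀ xs x y ys → zs ≡ xs ++ x ∷ y ∷ ys → R x y) → Chain R zs
  Chain-intro []           r = tt
  Chain-intro (x ∷ [])     r = tt
  Chain-intro (x ∷ y ∷ zs) r =
    r [] x y zs refl , Chain-intro (y ∷ zs) (λ xs a b ys e → r (x ∷ xs) a b ys (cong (x ∷_) e))

  Chain₃-intro : ∀ {R} zs → (∀ xs x y z ys → zs ≡ xs ++ x ∷ y ∷ z ∷ ys → R x y z) → Chain₃ R zs
  Chain₃-intro []               r = tt
  Chain₃-intro (x ∷ [])         r = tt
  Chain₃-intro (x ∷ y ∷ [])     r = tt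
  Chain₃-intro (x ∷ y ∷ z ∷ zs) r =
    r [] x y z zs refl , Chain₃-intro (y ∷ z ∷ zs) (λ xs a b c ys e → r (x ∷ xs) a b c ys (cong (x ∷_) e))

  reverse-++-∷∷ : ∀ xs (x y : A) ys → reverse (xs ++ x ∷ y ∷ ys) ≡ reverse ys ++ y ∷ x ∷ reverse xs
  reverse-++-∷∷ xs x y ys = begin
      reverse (xs ++ x ∷ y ∷ ys)
    ≡⟨ reverse-++ xs (x ∷ y ∷ ys) ⟩
      reverse (x ∷ y ∷ ys) ++ reverse xs
    ≡⟨ cong (_++ reverse xs) (trans (unfold-reverse x (y ∷ ys)) (cong (_∷ʳ x) (unfold-reverse y ys))) ⟩
      ((reverse ys ∷ʳ y) ∷ʳ x) ++ reverse xs
    ≡⟨ ++-assoc (reverse ys ∷ʳ y) [ x ] (reverse xs) ⟩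
      (reverse ys ∷ʳ y) ++ x ∷ reverse xs
    ≡⟨ ++-assoc (reverse ys) [ y ] (x ∷ reverse xs) ⟩
      reverse ys ++ y ∷ x ∷ reverse xs ∎
    where open ≡-Reasoning

  reverse-++-∷∷∷ : ∀ xs (x y z : A) ys → reverse (xs ++ x ∷ y ∷ z ∷ ys) ≡ reverse ys ++ z ∷ y ∷ x ∷ reverse xs
  reverse-++-∷∷∷ xs x y z ys = begin
      reverse (xs ++ x ∷ y ∷ z ∷ ys)
    ≡⟨ cong reverse (sym (++-assoc xs [ x ] (y ∷ z ∷ ys))) ⟩
      reverse ((xs ++ [ x ]) ++ y ∷ z ∷ ys)
    ≡⟨ reverse-++-∷∷ (xs ++ [ x ]) y z ys ⟩
      reverse ys ++ z ∷ y ∷ reverse (xs ++ [ x ])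
    ≡⟨ cong (λ t → reverse ys ++ z ∷ y ∷ t) (reverse-++ xs [ x ]) ⟩
      reverse ys ++ z ∷ y ∷ x ∷ reverse xs ∎
    where open ≡-Reasoning

  Chain-reverse : ∀ {R} zs → Chain R zs → Chain (flip R) (reverse zs)
  Chain-reverse {R} zs c = Chain-intro (reverse zs) λ xs x y ys e →
    Chain-at (reverse ys) y x (reverse xs)
      (subst (Chain R) (trans (sym (reverse-involutive zs)) (trans (cong reverse e) (reverse-++-∷∷ xs x y ys))) c)

  Chain₃-reverse : ∀ {R} zs → Chain₃ R zs → Chain₃ (λ x y z → R z y x) (reverse zs)
  Chain₃-reverse {R} zs c = Chain₃-intro (reverse zs) λ xs x y z ys e →
    Chain₃-at (reverse ys) z y x (reverse xs)
      (subst (Chain₃ R) (trans (sym (reverse-involutive zs)) (trans (cong reverse e) (reverse-++-∷∷∷ xs x y z ys))) c)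

  All-reverse : ∀ {P : A → Set} xs → All P xs → All P (reverse xs)
  All-reverse []       _          = []
  All-reverse (x ∷ xs) (px ∷ pxs) =
    subst (All _) (sym (unfold-reverse x xs)) (All.++⁺ (All-reverse xs pxs) (px ∷ []))

  Chain-tabulate : ∀ {L} {R} (p : Fin L → A) →
    (∀ i j → toℕ j ≡ suc (toℕ i) → R (p i) (p j)) → Chain R (tabulate p)
  Chain-tabulate {zero}        p r = tt
  Chain-tabulate {suc zero}    p r = tt
  Chain-tabulate {suc (suc L)} p r =
    r zero (suc zero) refl , Chain-tabulate (p ∘ suc) (λ i j e → r (suc i) (suc j) (cong suc e))

  BrokenWindow : ∀ {L} → (A → A → A → Set) → (Fin L → A) → Set
  BrokenWindow {L} R p = Σ (Fin L) λ i → Σ (Fin L) λ j → Σ (Fin L) λ l →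
    toℕ j ≡ suc (toℕ i) × toℕ l ≡ suc (toℕ j) × ¬ R (p i) (p j) (p l)

  ¬Chain₃-tabulate : ∀ L {R : A → A → A → Set} → (∀ x y z → Dec (R x y z)) → (p : Fin L → A) →
    ¬ Chain₃ R (tabulate p) → BrokenWindow R p
  ¬Chain₃-tabulate zero             R? p ¬c = ⊥-elim (¬c tt)
  ¬Chain₃-tabulate (suc zero)       R? p ¬c = ⊥-elim (¬c tt)
  ¬Chain₃-tabulate (suc (suc zero)) R? p ¬c = ⊥-elim (¬c tt)
  ¬Chain₃-tabulate (suc (suc (suc L))) {R} R? p ¬c =
    Data.Sum.[ (λ ¬r → zero , suc zero , suc (suc zero) , refl , refl , ¬r)
             , (λ ¬cs → shift (¬Chain₃-tabulate (suc (suc L)) R? (p ∘ suc) ¬cs)) ]′ first-or-rest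
    where
    first-or-rest : ¬ R (p zero) (p (suc zero)) (p (suc (suc zero))) ⊎ ¬ Chain₃ R (tabulate (p ∘ suc))
    first-or-rest with R? (p zero) (p (suc zero)) (p (suc (suc zero)))
    ... | yes r = inj₂ (λ c → ¬c (r , c))
    ... | no ¬r = inj₁ ¬r
    shift : BrokenWindow R (p ∘ suc) → BrokenWindow R p
    shift (i , j , l , ij , jl , ¬r) = suc i , suc j , suc l , cong suc ij , cong suc jl , ¬r

module Occurrences {A : Set} (_≟ₐ_ : (x y : A) → Dec (x ≡ y)) where
  open Sums

  occ : A → List A → ℕ
  occ x []       = 0
  occ x (y ∷ ys) = 𝟙 (x ≟ₐ y) + occ x ys

  occ-++ : ∀ x xs ys → occ x (xs ++ ys) ≡ occ x xs + occ x ys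
  occ-++ x []       ys = refl
  occ-++ x (y ∷ xs) ys = trans (cong (𝟙 (x ≟ₐ y) +_) (occ-++ x xs ys)) (sym (+-assoc (𝟙 (x ≟ₐ y)) _ _))

  occ-reverse : ∀ x xs → occ x (reverse xs) ≡ occ x xs
  occ-reverse x []       = refl
  occ-reverse x (y ∷ xs) = begin
      occ x (reverse (y ∷ xs))
    ≡⟨ cong (occ x) (unfold-reverse y xs) ⟩
      occ x (reverse xs ++ [ y ])
    ≡⟨ occ-++ x (reverse xs) [ y ] ⟩
      occ x (reverse xs) + (𝟙 (x ≟ₐ y) + 0)
    ≡⟨ cong₂ _+_ (occ-reverse x xs) (+-identityʳ _) ⟩
      occ x xs + 𝟙 (x ≟ₐ y)
    ≡⟨ +-comm (occ x xs) _ ⟩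
      𝟙 (x ≟ₐ y) + occ x xs ∎
    where open ≡-Reasoning

  ∈⇒occ-pos : ∀ {x xs} → x ∈ xs → 1 ≤ occ x xs
  ∈⇒occ-pos {x} (here refl) = ≤-trans (≤-reflexive (sym (𝟙-yes (x ≟ₐ x) refl))) (m≤m+n _ _)
  ∈⇒occ-pos {x} {y ∷ xs} (there p) = ≤-trans (∈⇒occ-pos p) (m≤n+m _ _)

  occ-∉ : ∀ x xs → x ∉ xs → occ x xs ≡ 0
  occ-∉ x []       _  = refl
  occ-∉ x (y ∷ xs) x∉ = cong₂ _+_ (𝟙-no (x ≟ₐ y) (λ e → x∉ (here e))) (occ-∉ x xs (x∉ ∘ there))

  -- Distinctness via occurrence counts: sublist and rearrangement steps become inequalities of sums.
  record Distinct (xs : List A) : Set where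
    constructor distinct
    field occ≤1 : ∀ x → occ x xs ≤ 1
  open Distinct public

  Distinct-fewer : ∀ xs ys → (∀ x → occ x xs ≤ occ x ys) → Distinct ys → Distinct xs
  Distinct-fewer xs ys le d = distinct (λ x → ≤-trans (le x) (occ≤1 d x))

  Distinct-head : ∀ {x xs} → Distinct (x ∷ xs) → x ∉ xs
  Distinct-head {x} {xs} d x∈ = <-irrefl refl (begin-strict
      1
    <⟨ +-monoʳ-≤ 1 (∈⇒occ-pos x∈) ⟩
      1 + occ x xs
    ≡⟨ cong (_+ occ x xs) (sym (𝟙-yes (x ≟ₐ x) refl)) ⟩
      occ x (x ∷ xs)
    ≤⟨ occ≤1 d x ⟩
      1 ∎)
    where open ≤-Reasoning

  Distinct-tail : ∀ {x xs} → Distinct (x ∷ xs) → Distinct xs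
  Distinct-tail d = distinct (λ y → ≤-trans (m≤n+m _ _) (occ≤1 d y))

  Distinct-∷ : ∀ {x xs} → x ∉ xs → Distinct xs → Distinct (x ∷ xs)
  Distinct-∷ {x} {xs} x∉ d = distinct count
    where
    count : ∀ y → occ y (x ∷ xs) ≤ 1
    count y with y ≟ₐ x
    ... | yes refl = ≤-reflexive (cong suc (occ-∉ y xs x∉))
    ... | no _     = occ≤1 d y

  occ-++-comm : ∀ x xs ys → occ x (xs ++ ys) ≡ occ x (ys ++ xs)
  occ-++-comm x xs ys = trans (occ-++ x xs ys) (trans (+-comm (occ x xs) _) (sym (occ-++ x ys xs)))

  Distinct-∷-++⁻ʳ : ∀ x ys zs → Distinct (x ∷ ys ++ zs) → Distinct (x ∷ zs)
  Distinct-∷-++⁻ʳ x ys zs = Distinct-fewer (x ∷ zs) (x ∷ ys ++ zs) λ y →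
    +-monoʳ-≤ (𝟙 (y ≟ₐ x)) (≤-trans (m≤n+m (occ y zs) (occ y ys)) (≤-reflexive (sym (occ-++ y ys zs))))

module VertexLists (n : ℕ) where
  open Occurrences (_≟_ {n}) public

  Distinct? : ∀ xs → Dec (Distinct xs)
  Distinct? xs with Fin.all? (λ x → occ x xs ≤? 1)
  ... | yes p = yes (distinct p)
  ... | no ¬p = no (¬p ∘ occ≤1)

  tabulate-Distinct : ∀ {L} (p : Fin L → Fin n) → (∀ {i j} → p i ≡ p j → i ≡ j) → Distinct (tabulate p)
  tabulate-Distinct {zero}  p inj = distinct (λ _ → z≤n)
  tabulate-Distinct {suc L} p inj =
    Distinct-∷ (λ m → case (∈-tabulate⁻ m)) (tabulate-Distinct (p ∘ suc) (Fin.suc-injective ∘ inj))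
    where
    case : (∃ λ i → p zero ≡ p (suc i)) → ⊥
    case (i , e) with inj e
    ... | ()

  AllOfLength : ℕ → (List (Fin n) → Set) → Set
  AllOfLength zero    R = R []
  AllOfLength (suc L) R = ∀ x → AllOfLength L (R ∘ (x ∷_))

  AllOfLength? : ∀ L {R : List (Fin n) → Set} → (∀ xs → Dec (R xs)) → Dec (AllOfLength L R)
  AllOfLength? zero    R? = R? []
  AllOfLength? (suc L) R? = Fin.all? (λ x → AllOfLength? L (R? ∘ (x ∷_)))

  AllOfLength-apply : ∀ L {R} → AllOfLength L R → ∀ xs → length xs ≡ L → R xs
  AllOfLength-apply zero    a []       e = a
  AllOfLength-apply (suc L) a (x ∷ xs) e = AllOfLength-apply L (a x) xs (suc-injective e)

  AllOfLength-intro : ∀ L {R} → (∀ xs → length xs ≡ L → R xs) → AllOfLength L R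
  AllOfLength-intro zero    r   = r [] refl
  AllOfLength-intro (suc L) r x = AllOfLength-intro L (λ xs e → r (x ∷ xs) (cong suc e))

  AllOfLength-map : ∀ L {R R′} → (∀ xs → R xs → R′ xs) → AllOfLength L R → AllOfLength L R′
  AllOfLength-map zero    f a   = f [] a
  AllOfLength-map (suc L) f a x = AllOfLength-map L (f ∘ (x ∷_)) (a x)

  ¬AllOfLength¬ : ∀ L {R} → (∀ xs → Dec (R xs)) → ¬ AllOfLength L (¬_ ∘ R) → ∃ λ xs → length xs ≡ L × R xs
  ¬AllOfLength¬ zero R? ¬a with R? []
  ... | yes r = [] , refl , r
  ... | no ¬r = ⊥-elim (¬a ¬r)
  ¬AllOfLength¬ (suc L) R? ¬a
    with Fin.¬∀⟶∃¬ _ _ (λ x → AllOfLength? L (λ xs → ¬? (R? (x ∷ xs)))) ¬a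
  ... | x , ¬ax with ¬AllOfLength¬ L (R? ∘ (x ∷_)) ¬ax
  ...   | xs , e , r = x ∷ xs , cong suc e , r

module PartialColourings (N : ℕ) where
  open Sums

  Colour = Maybe (Fin N)

  -- A partial colouring of m vertices is a Vec Colour m; ∑Col S F sums F over those with domain S.
  ∑Col : ∀ {m} → Vec Bool m → (Vec Colour m → ℕ) → ℕ
  ∑Col []          F = F []
  ∑Col (false ∷ S) F = ∑Col S (λ g → F (nothing ∷ g))
  ∑Col (true ∷ S)  F = ∑Fin N (λ c → ∑Col S (λ g → F (just c ∷ g)))

  data Domain : ∀ {m} → Vec Bool m → Vec Colour m → Set where
    []   : Domain [] []
    _∷ᶜ_ : ∀ {m} {S : Vec Bool m} {g} c → Domain S g → Domain (true ∷ S) (just c ∷ g)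
    ∷ᵘ_  : ∀ {m} {S : Vec Bool m} {g} → Domain S g → Domain (false ∷ S) (nothing ∷ g)

  ∑Col-cong : ∀ {m} (S : Vec Bool m) {F G} → (∀ g → F g ≡ G g) → ∑Col S F ≡ ∑Col S G
  ∑Col-cong []          e = e []
  ∑Col-cong (false ∷ S) e = ∑Col-cong S (λ g → e _)
  ∑Col-cong (true ∷ S)  e = ∑Fin-cong N (λ c → ∑Col-cong S (λ g → e _))

  ∑Col-+ : ∀ {m} (S : Vec Bool m) F G → ∑Col S (λ g → F g + G g) ≡ ∑Col S F + ∑Col S G
  ∑Col-+ []          F G = refl
  ∑Col-+ (false ∷ S) F G = ∑Col-+ S _ _
  ∑Col-+ (true ∷ S)  F G = trans (∑Fin-cong N (λ c → ∑Col-+ S _ _)) (∑Fin-+ N _ _)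

  ∑Col-0 : ∀ {m} (S : Vec Bool m) → ∑Col S (λ _ → 0) ≡ 0
  ∑Col-0 []          = refl
  ∑Col-0 (false ∷ S) = ∑Col-0 S
  ∑Col-0 (true ∷ S)  = trans (∑Fin-cong N (λ c → ∑Col-0 S)) (∑Fin-0 N)

  ∑Col-mono : ∀ {m} (S : Vec Bool m) {F G} → (∀ g → Domain S g → F g ≤ G g) → ∑Col S F ≤ ∑Col S G
  ∑Col-mono []          e = e [] []
  ∑Col-mono (false ∷ S) e = ∑Col-mono S (λ g d → e _ (∷ᵘ d))
  ∑Col-mono (true ∷ S)  e = ∑Fin-mono N (λ c → ∑Col-mono S (λ g d → e _ (c ∷ᶜ d)))

  ∑Col-summation : ∀ {m} (S : Vec Bool m) → Summation (Vec Colour m)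
  ∑Col-summation S = record
    { ∑ = ∑Col S ; ∑-cong = ∑Col-cong S ; ∑-+ = ∑Col-+ S ; ∑-0 = ∑Col-0 S
    ; ∑-mono = λ e → ∑Col-mono S (λ g _ → e g) }

  ∑Col-extend : ∀ {m} (S : Vec Bool m) (v : Fin m) (F : Vec Colour m → ℕ) → lookup S v ≡ false →
    ∑Col (S [ v ]≔ true) F ≡ ∑Col S (λ g → ∑Fin N (λ c → F (g [ v ]≔ just c)))
  ∑Col-extend (false ∷ S) zero    F e = ∑Fin-∑ (∑Col-summation S) N (λ c g → F (just c ∷ g))
  ∑Col-extend (false ∷ S) (suc v) F e = ∑Col-extend S v _ e
  ∑Col-extend (true ∷ S)  (suc v) F e = ∑Fin-cong N (λ c → ∑Col-extend S v _ e)

  ∑Col-𝟙-none : ∀ {m} (S : Vec Bool m) {P : Vec Colour m → Set} (P? : ∀ g → Dec (P g)) → (∀ g → ¬ P g) →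
    ∑Col S (𝟙 ∘ P?) ≡ 0
  ∑Col-𝟙-none S P? none = trans (∑Col-cong S (λ g → 𝟙-no (P? g) (none g))) (∑Col-0 S)

  ∑Col-positive : ∀ {m} (S : Vec Bool m) F → 1 ≤ ∑Col S F → ∃ λ g → Domain S g × 1 ≤ F g
  ∑Col-positive []          F p = [] , [] , p
  ∑Col-positive (false ∷ S) F p with ∑Col-positive S _ p
  ... | g , d , q = _ , ∷ᵘ d , q
  ∑Col-positive (true ∷ S)  F p with ∑Fin-positive N _ p
  ... | c , q with ∑Col-positive S _ q
  ...   | g , d , r = _ , c ∷ᶜ d , r

  ∑Col-empty : ∀ {m} (F : Vec Colour m → ℕ) → ∑Col (replicate m false) F ≡ F (replicate m nothing)
  ∑Col-empty {zero}  F = refl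
  ∑Col-empty {suc m} F = ∑Col-empty (λ g → F (nothing ∷ g))

  Domain-∉ : ∀ {m} {S : Vec Bool m} {g} → Domain S g → ∀ u → lookup S u ≡ false → lookup g u ≡ nothing
  Domain-∉ (∷ᵘ d)   zero    e = refl
  Domain-∉ (c ∷ᶜ d) (suc u) e = Domain-∉ d u e
  Domain-∉ (∷ᵘ d)   (suc u) e = Domain-∉ d u e

  Domain-∈ : ∀ {m} {S : Vec Bool m} {g} → Domain S g → ∀ u c → lookup g u ≡ just c → lookup S u ≡ true
  Domain-∈ (c ∷ᶜ d) zero    _ e = refl
  Domain-∈ (c ∷ᶜ d) (suc u) a e = Domain-∈ d u a e
  Domain-∈ (∷ᵘ d)   (suc u) a e = Domain-∈ d u a e

  totalise : ∀ {m} {g : Vec Colour m} → Domain (replicate m true) g → Fin m → Fin N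
  totalise (c ∷ᶜ d) zero    = c
  totalise (c ∷ᶜ d) (suc u) = totalise d u

  lookup-totalise : ∀ {m} {g : Vec Colour m} (d : Domain (replicate m true) g) u → lookup g u ≡ just (totalise d u)
  lookup-totalise (c ∷ᶜ d) zero    = refl
  lookup-totalise (c ∷ᶜ d) (suc u) = lookup-totalise d u

card : ∀ {m} → Vec Bool m → ℕ
card []          = 0
card (true ∷ S)  = suc (card S)
card (false ∷ S) = card S

card-remove : ∀ {m} (S : Vec Bool m) v → lookup S v ≡ true → card (S [ v ]≔ false) < card S
card-remove (true ∷ S)  zero    e = ≤-refl
card-remove (true ∷ S)  (suc v) e = s≤s (card-remove S v e)
card-remove (false ∷ S) (suc v) e = card-remove S v e

_∈ˢ_ : ∀ {m} → Fin m → Vec Bool m → Set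
u ∈ˢ S = lookup S u ≡ true

all-false : ∀ {m} (T : Vec Bool m) → (∀ u → lookup T u ≡ false) → T ≡ replicate m false
all-false []      _       = refl
all-false (b ∷ T) ≡false = cong₂ _∷_ (≡false zero) (all-false T (≡false ∘ suc))

module Neighbourhoods {n : ℕ} (G : Graph n) where

  Adj : Fin n → Fin n → Set
  Adj u w = adj G u w ≡ true

  Adj? : ∀ u w → Dec (Adj u w)
  Adj? u w = adj G u w Bool.≟ true

  Adj-sym : ∀ {u w} → Adj u w → Adj w u
  Adj-sym {u} {w} e = trans (Graph.sym G w u) e

  nbrs : Fin n → List (Fin n)
  nbrs v = filterᵇ (adj G v) (allFin n)

  ∈-nbrs : ∀ {v u} → Adj v u → u ∈ nbrs v
  ∈-nbrs {v} {u} e = ∈-filter⁺ (T? ∘ adj G v) (∈-allFin u) (subst T (sym e) tt)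

  nbrs-Adj : ∀ {v u} → u ∈ nbrs v → Adj v u
  nbrs-Adj {v} {u} m with adj G v u | proj₂ (∈-filter⁻ (T? ∘ adj G v) {xs = allFin n} m)
  ... | true | _ = refl

module GoodColourings {n : ℕ} (G : Graph n) (k N : ℕ) where
  open Sums
  open Windows
  open VertexLists n
  open PartialColourings N
  open Neighbourhoods G

  Colouring = Vec Colour n

  _≟ᶜ_ : ∀ (a b : Colour) → Dec (a ≡ b)
  _≟ᶜ_ = Maybe.≡-dec _≟_

  Coloured : Colouring → Fin n → Set
  Coloured h u = ∃ λ c → lookup h u ≡ just c

  Coloured? : ∀ h u → Dec (Coloured h u)
  Coloured? h u with lookup h u
  ... | just c  = yes (c , refl)
  ... | nothing = no λ ()

  Clash : Colouring → Fin n → Fin n → Set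
  Clash h u w = Coloured h u × lookup h u ≡ lookup h w

  ProperPartial : Colouring → Set
  ProperPartial h = ∀ u w → Adj u w → ¬ Clash h u w

  opaque
    ProperPartial? : ∀ h → Dec (ProperPartial h)
    ProperPartial? h =
      Fin.all? λ u → Fin.all? λ w → Adj? u w →-dec ¬? (Coloured? h u ×-dec (lookup h u ≟ᶜ lookup h w))

  Alternating : Colouring → List (Fin n) → Set
  Alternating h = Chain₃ (λ x _ z → lookup h x ≡ lookup h z)

  BicolouredPath : Colouring → List (Fin n) → Set
  BicolouredPath h Q = Chain Adj Q × Distinct Q × All (Coloured h) Q × Alternating h Q

  opaque
    BicolouredPath? : ∀ h Q → Dec (BicolouredPath h Q)
    BicolouredPath? h Q =
      Chain? Adj? Q ×-dec (Distinct? Q ×-dec (All.all? (Coloured? h) Q ×-dec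
        Chain₃? (λ x _ z → lookup h x ≟ᶜ lookup h z) Q))

  Good : Colouring → Set
  Good h = ProperPartial h × AllOfLength (2 * k) (¬_ ∘ BicolouredPath h)

  opaque
    Good? : ∀ h → Dec (Good h)
    Good? h = ProperPartial? h ×-dec AllOfLength? (2 * k) (¬? ∘ BicolouredPath? h)

  #Good : Vec Bool n → ℕ
  #Good S = ∑Col S (𝟙 ∘ Good?)

  _⊑_ : Colouring → Colouring → Set
  g ⊑ h = ∀ u c → lookup g u ≡ just c → lookup h u ≡ just c

  module _ {g h : Colouring} (g⊑h : g ⊑ h) where
    Coloured-⊑ : ∀ {u} → Coloured g u → Coloured h u
    Coloured-⊑ {u} (c , e) = c , g⊑h u c e

    agree-⊑ : ∀ {u w} → Coloured g u → lookup g u ≡ lookup g w → lookup h u ≡ lookup h w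
    agree-⊑ {u} {w} (c , eu) e = trans (g⊑h u c eu) (sym (g⊑h w c (trans (sym e) eu)))

    Alternating-⊑ : ∀ Q → All (Coloured g) Q → Alternating g Q → Alternating h Q
    Alternating-⊑ []                _                    _       = tt
    Alternating-⊑ (x ∷ [])          _                    _       = tt
    Alternating-⊑ (x ∷ y ∷ [])      _                    _       = tt
    Alternating-⊑ (x ∷ y ∷ z ∷ Q) (cx ∷ cy ∷ cz ∷ cs) (e , a) =
      agree-⊑ cx e , Alternating-⊑ (y ∷ z ∷ Q) (cy ∷ cz ∷ cs) a

    BicolouredPath-⊑ : ∀ Q → BicolouredPath g Q → BicolouredPath h Q
    BicolouredPath-⊑ Q (c , d , cs , a) = c , d , All.map Coloured-⊑ cs , Alternating-⊑ Q cs a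

    Good-⊑ : Good h → Good g
    Good-⊑ (pr , nb) =
      (λ u w a (cu , e) → pr u w a (Coloured-⊑ cu , agree-⊑ cu e)) ,
      AllOfLength-map (2 * k) (λ Q ¬b b → ¬b (BicolouredPath-⊑ Q b)) nb

  Good-empty : 1 ≤ k → Good (replicate n nothing)
  Good-empty k≥1 = (λ u _ _ ((_ , e) , _) → uncoloured u e) , AllOfLength-intro (2 * k) nonempty
    where
    uncoloured : ∀ u {c} → lookup (replicate n nothing) u ≢ just c
    uncoloured u e with trans (sym (lookup-replicate u nothing)) e
    ... | ()
    nonempty : ∀ Q → length Q ≡ 2 * k → ¬ BicolouredPath (replicate n nothing) Q
    nonempty []      e _                          = 1+n≰n {0} (subst (1 ≤_) (sym e) (≤-trans k≥1 (m≤m+n k _)))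
    nonempty (x ∷ Q) _ (_ , _ , (_ , c) ∷ _ , _) = uncoloured x c

  Good⇒StarKColoring : ∀ {g} (d : Domain (replicate n true) g) → Good g → StarKColoring k G (totalise d)
  Good⇒StarKColoring {g} d (pr , nb) = proper , threeColours
    where
    f = totalise d
    coloured : ∀ u → lookup g u ≡ just (f u)
    coloured = lookup-totalise d
    proper : Proper G f
    proper u w a e = pr u w a ((f u , coloured u) , trans (coloured u) (trans (cong just e) (sym (coloured w))))
    threeColours : ∀ p → IsPath G (2 * k) p → ThreeColours f p
    threeColours p (inj , steps)
      with ¬Chain₃-tabulate (2 * k) (λ x _ z → lookup g x ≟ᶜ lookup g z) p
             (λ alt → AllOfLength-apply (2 * k) nb (tabulate p) (length-tabulate p)
                (Chain-tabulate p steps , tabulate-Distinct p inj , All.universal (λ u → f u , coloured u) _ , alt))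
    ... | i , j , l , ij , jl , ¬alt =
      i , j , l , proper (p i) (p j) (steps i j ij) ,
      (λ e → ¬alt (trans (coloured (p i)) (trans (cong just e) (sym (coloured (p l)))))) ,
      proper (p j) (p l) (steps j l jl)

  Coloured-unset : ∀ (g : Colouring) v c {u} → u ≢ v → Coloured (g [ v ]≔ just c) u → Coloured g u
  Coloured-unset g v c u≢v (d , e) = d , trans (sym (lookup∘update′ u≢v g (just c))) e

  ≔-unchanged-on : ∀ (g : Colouring) v c xs → v ∉ xs → All (λ u → lookup (g [ v ]≔ just c) u ≡ lookup g u) xs
  ≔-unchanged-on g v c []       _  = []
  ≔-unchanged-on g v c (y ∷ xs) v∉ = lookup∘update′ (λ e → v∉ (here (sym e))) g (just c) ∷ ≔-unchanged-on g v c xs (v∉ ∘ there)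

  ⊑-≔ : ∀ (g : Colouring) w c → lookup g w ≡ nothing → g ⊑ (g [ w ]≔ just c)
  ⊑-≔ g w c gw≡nothing u d e with u ≟ w
  ... | yes refl with trans (sym gw≡nothing) e
  ...   | ()
  ⊑-≔ g w c gw≡nothing u d e | no u≢w = trans (lookup∘update′ u≢w g (just c)) e

  BicolouredPath-transport : ∀ h g Q → All (λ u → lookup h u ≡ lookup g u) Q → BicolouredPath h Q → BicolouredPath g Q
  BicolouredPath-transport h g Q agree (c , d , cs , a) = c , d , coloured Q agree cs , alternating Q agree a
    where
    coloured : ∀ Q → All (λ u → lookup h u ≡ lookup g u) Q → All (Coloured h) Q → All (Coloured g) Q
    coloured []      _          _              = []
    coloured (y ∷ Q) (e ∷ agree) ((c , d) ∷ cs) = (c , trans (sym e) d) ∷ coloured Q agree cs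
    alternating : ∀ Q → All (λ u → lookup h u ≡ lookup g u) Q → Alternating h Q → Alternating g Q
    alternating []               _                       _       = tt
    alternating (x ∷ [])         _                       _       = tt
    alternating (x ∷ y ∷ [])     _                       _       = tt
    alternating (x ∷ y ∷ z ∷ Q) (ex ∷ ey ∷ ez ∷ agree) (e , a) =
      trans (sym ex) (trans e ez) , alternating (y ∷ z ∷ Q) (ey ∷ ez ∷ agree) a

module NonBacktrackingWalks {n : ℕ} (G : Graph n) (Δ : ℕ) (maxdeg : ∀ v → degree G v ≤ Δ) where
  open Sums
  open Neighbourhoods G
  open VertexLists n
  open Windows

  onward : Fin n → Fin n → List (Fin n)
  onward p c = filter (λ x → ¬? (x ≟ p)) (nbrs c)

  length-onward : ∀ {p c} → Adj c p → length (onward p c) ≤ Δ ∸ 1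
  length-onward {p} {c} a =
    ≤-trans (<⇒≤pred (≤-trans (filter-notAll (λ x → ¬? (x ≟ p)) (nbrs c) p-removed) (maxdeg c)))
            (≤-reflexive (pred[m∸n]≡m∸[1+n] Δ 0))
    where
    p-removed : Any (λ x → ¬ ¬ x ≡ p) (nbrs c)
    p-removed = Any.map (λ e ¬e → ¬e (sym e)) (∈-nbrs a)

  ∈-onward : ∀ {p c x} → Adj c x → x ≢ p → x ∈ onward p c
  ∈-onward {p} a x≢p = ∈-filter⁺ (λ x → ¬? (x ≟ p)) (∈-nbrs a) x≢p

  onward-Adj : ∀ {p c x} → x ∈ onward p c → Adj c x
  onward-Adj {p} {c} m = nbrs-Adj (proj₁ (∈-filter⁻ (λ x → ¬? (x ≟ p)) {xs = nbrs c} m))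

  data Walk : Fin n → Fin n → List (Fin n) → Set where
    []  : ∀ {p c} → Walk p c []
    _∷_ : ∀ {p c x ws} → x ∈ onward p c → Walk c x ws → Walk p c (x ∷ ws)

  Path⇒Walk : ∀ p c ws → Chain Adj (c ∷ ws) → Distinct (p ∷ c ∷ ws) → Walk p c ws
  Path⇒Walk p c []       _       _ = []
  Path⇒Walk p c (y ∷ ws) (a , ch) d =
    ∈-onward a (λ y≡p → Distinct-head d (there (here (sym y≡p)))) ∷ Path⇒Walk c y ws ch (Distinct-tail d)

  ∑Walks : Fin n → Fin n → ℕ → (List (Fin n) → ℕ) → ℕ
  ∑Walks p c zero    F = F []
  ∑Walks p c (suc L) F = ∑List (onward p c) (λ x → ∑Walks c x L (F ∘ (x ∷_)))

  ∑Walks-≥ : ∀ {p c ws} (F : List (Fin n) → ℕ) → Walk p c ws → F ws ≤ ∑Walks p c (length ws) F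
  ∑Walks-≥ F [] = ≤-refl
  ∑Walks-≥ {p} {c} {x ∷ ws} F (m ∷ w) =
    ≤-trans (∑Walks-≥ (F ∘ (x ∷_)) w) (∑List-≥ (λ y → ∑Walks c y (length ws) (F ∘ (y ∷_))) m)

  ∑Walks-≤ : ∀ L {p c} {F : List (Fin n) → ℕ} {M} → Adj c p → (∀ ws → F ws ≤ M) →
    ∑Walks p c L F ≤ (Δ ∸ 1) ^ L * M
  ∑Walks-≤ zero    a b = ≤-trans (b []) (≤-reflexive (sym (+-identityʳ _)))
  ∑Walks-≤ (suc L) {p} {c} {F} {M} a b = begin
      ∑List (onward p c) (λ x → ∑Walks c x L (F ∘ (x ∷_)))
    ≤⟨ ∑List-≤-* (onward p c) (λ x m → ∑Walks-≤ L (Adj-sym (onward-Adj m)) (b ∘ (x ∷_))) ⟩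
      length (onward p c) * ((Δ ∸ 1) ^ L * M)
    ≤⟨ *-monoˡ-≤ _ (length-onward a) ⟩
      (Δ ∸ 1) * ((Δ ∸ 1) ^ L * M)
    ≡⟨ sym (*-assoc (Δ ∸ 1) _ M) ⟩
      (Δ ∸ 1) ^ suc L * M ∎
    where open ≤-Reasoning

  ∑Walks-cong : ∀ L p c {F F′ : List (Fin n) → ℕ} → (∀ ws → F ws ≡ F′ ws) → ∑Walks p c L F ≡ ∑Walks p c L F′
  ∑Walks-cong zero    p c e = e []
  ∑Walks-cong (suc L) p c e = ∑List-cong (onward p c) (λ x → ∑Walks-cong L c x (e ∘ (x ∷_)))

  ∑Walks-mono : ∀ L p c {F F′ : List (Fin n) → ℕ} → (∀ ws → F ws ≤ F′ ws) → ∑Walks p c L F ≤ ∑Walks p c L F′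
  ∑Walks-mono zero    p c e = e []
  ∑Walks-mono (suc L) p c e = ∑List-mono (onward p c) (λ x → ∑Walks-mono L c x (e ∘ (x ∷_)))

  ∑Walks-∑ : ∀ {I} (X : Summation I) L p c (H : List (Fin n) → I → ℕ) →
    ∑Walks p c L (λ ws → ∑ X (H ws)) ≡ ∑ X (λ i → ∑Walks p c L (λ ws → H ws i))
  ∑Walks-∑ X zero    p c H = refl
  ∑Walks-∑ X (suc L) p c H =
    trans (∑List-cong (onward p c) (λ x → ∑Walks-∑ X L c x (H ∘ (x ∷_))))
          (∑List-∑ X (onward p c) (λ x i → ∑Walks c x L (λ ws → H (x ∷ ws) i)))

  module Arms (k : ℕ) where

    m : ℕ
    m = 2 * k ∸ 2

    -- A path on 2k vertices through v splits at v into a left arm of length j and a right arm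
    -- b ∷ bs of length 2k-1-j; reversing the path if necessary we may assume j < k.
    ∑Arms : Fin n → (List (Fin n) → List (Fin n) → ℕ) → ℕ
    ∑Arms v F = ∑Fin k λ j → ∑List (nbrs v) λ b →
      ∑Walks v b (m ∸ toℕ j) λ bs → ∑Walks b v (toℕ j) λ as → F as (b ∷ bs)

    ∑Arms-mono : ∀ v {F F′} → (∀ as bs → F as bs ≤ F′ as bs) → ∑Arms v F ≤ ∑Arms v F′
    ∑Arms-mono v e = ∑Fin-mono k λ j → ∑List-mono (nbrs v) λ b →
      ∑Walks-mono (m ∸ toℕ j) v b λ bs → ∑Walks-mono (toℕ j) b v λ as → e as (b ∷ bs)

    ∑Arms-∑ : ∀ {I} (X : Summation I) v (H : List (Fin n) → List (Fin n) → I → ℕ) →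
      ∑Arms v (λ as bs → ∑ X (H as bs)) ≡ ∑ X (λ i → ∑Arms v (λ as bs → H as bs i))
    ∑Arms-∑ X v H =
      trans (∑Fin-cong k λ j → trans (∑List-cong (nbrs v) λ b →
               trans (∑Walks-cong (m ∸ toℕ j) v b (λ bs → ∑Walks-∑ X (toℕ j) b v (λ as → H as (b ∷ bs))))
                     (∑Walks-∑ X (m ∸ toℕ j) v b (λ bs i → ∑Walks b v (toℕ j) (λ as → H as (b ∷ bs) i))))
             (∑List-∑ X (nbrs v) _))
        (∑Fin-∑ X k _)

    *-∑Arms : ∀ a v (F : List (Fin n) → List (Fin n) → ℕ) → a * ∑Arms v F ≤ ∑Arms v (λ as bs → a * F as bs)
    *-∑Arms a v F = begin
        a * ∑Arms v F
      ≡⟨ sym (∑Fin-const a (∑Arms v F)) ⟩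
        ∑Fin a (λ _ → ∑Arms v F)
      ≡⟨ sym (∑Arms-∑ (∑Fin-summation a) v (λ as bs _ → F as bs)) ⟩
        ∑Arms v (λ as bs → ∑Fin a (λ _ → F as bs))
      ≤⟨ ∑Arms-mono v (λ as bs → ≤-reflexive (∑Fin-const a (F as bs))) ⟩
        ∑Arms v (λ as bs → a * F as bs) ∎
      where open ≤-Reasoning

    ∑Arms-≤ : ∀ v {F} {M} → (∀ as bs → F as bs ≤ M) → ∑Arms v F ≤ k * (Δ * ((Δ ∸ 1) ^ m * M))
    ∑Arms-≤ v {F} {M} b = ∑Fin-≤-* k λ j → begin
        ∑List (nbrs v) (λ c → ∑Walks v c (m ∸ toℕ j) (λ bs → ∑Walks c v (toℕ j) (λ as → F as (c ∷ bs))))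
      ≤⟨ ∑List-≤-* (nbrs v) (λ c c∈ → ∑Walks-≤ (m ∸ toℕ j) (Adj-sym (nbrs-Adj c∈))
             (λ bs → ∑Walks-≤ (toℕ j) (nbrs-Adj c∈) (λ as → b as (c ∷ bs)))) ⟩
        length (nbrs v) * ((Δ ∸ 1) ^ (m ∸ toℕ j) * ((Δ ∸ 1) ^ toℕ j * M))
      ≤⟨ *-monoˡ-≤ _ (maxdeg v) ⟩
        Δ * ((Δ ∸ 1) ^ (m ∸ toℕ j) * ((Δ ∸ 1) ^ toℕ j * M))
      ≡⟨ cong (Δ *_) (sym (*-assoc ((Δ ∸ 1) ^ (m ∸ toℕ j)) _ M)) ⟩
        Δ * ((Δ ∸ 1) ^ (m ∸ toℕ j) * (Δ ∸ 1) ^ toℕ j * M)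
      ≡⟨ cong (λ e → Δ * (e * M)) (sym (^-distribˡ-+-* (Δ ∸ 1) (m ∸ toℕ j) (toℕ j))) ⟩
        Δ * ((Δ ∸ 1) ^ (m ∸ toℕ j + toℕ j) * M)
      ≡⟨ cong (λ e → Δ * ((Δ ∸ 1) ^ e * M)) (m∸n+n≡m (j≤m j)) ⟩
        Δ * ((Δ ∸ 1) ^ m * M) ∎
      where
      open ≤-Reasoning
      j≤m : ∀ (j : Fin k) → toℕ j ≤ m
      j≤m j = begin
          toℕ j         ≤⟨ <⇒≤pred (Fin.toℕ<n j) ⟩
          pred k        ≡⟨ pred[m∸n]≡m∸[1+n] k 0 ⟩
          k ∸ 1         ≤⟨ m≤n*m (k ∸ 1) 2 ⟩
          2 * (k ∸ 1)   ≡⟨ *-distribˡ-∸ 2 k 1 ⟩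
          m            ∎

    ∑Arms-≥ : ∀ v (F : List (Fin n) → List (Fin n) → ℕ) (j : Fin k) {b bs as} →
      b ∈ nbrs v → Walk v b bs → length bs ≡ m ∸ toℕ j → Walk b v as → length as ≡ toℕ j →
      F as (b ∷ bs) ≤ ∑Arms v F
    ∑Arms-≥ v F j {b} {bs} {as} b∈ wb lb wa la = begin
        F as (b ∷ bs)
      ≤⟨ ∑Walks-≥ (λ as → F as (b ∷ bs)) wa ⟩
        ∑Walks b v (length as) (λ as → F as (b ∷ bs))
      ≡⟨ cong (λ L → ∑Walks b v L (λ as → F as (b ∷ bs))) la ⟩
        inner bs
      ≤⟨ ∑Walks-≥ inner wb ⟩
        ∑Walks v b (length bs) inner
      ≡⟨ cong (λ L → ∑Walks v b L inner) lb ⟩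
        outer b
      ≤⟨ ∑List-≥ outer b∈ ⟩
        ∑List (nbrs v) outer
      ≤⟨ ∑Fin-≥ k _ j ⟩
        ∑Arms v F ∎
      where
      open ≤-Reasoning
      inner : List (Fin n) → ℕ
      inner bs = ∑Walks b v (toℕ j) (λ as → F as (b ∷ bs))
      outer : Fin n → ℕ
      outer c = ∑Walks v c (m ∸ toℕ j) (λ bs → ∑Walks c v (toℕ j) (λ as → F as (c ∷ bs)))

module Arithmetic where

  ^-distribʳ-* : ∀ a b e → (a * b) ^ e ≡ a ^ e * b ^ e
  ^-distribʳ-* a b zero    = refl
  ^-distribʳ-* a b (suc e) = trans (cong (a * b *_) (^-distribʳ-* a b e)) (interchange a b (a ^ e) (b ^ e))
    where
    interchange : ∀ a b c d → a * b * (c * d) ≡ a * c * (b * d)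
    interchange = solve-∀

  ^-positive : ∀ a e → 1 ≤ a → 1 ≤ a ^ e
  ^-positive a zero    _   = ≤-refl
  ^-positive a (suc e) a≥1 = *-mono-≤ a≥1 (^-positive a e a≥1)

  m≤m^n : ∀ a e → 1 ≤ e → a ≤ a ^ e
  m≤m^n zero    e       _ = z≤n
  m≤m^n (suc a) (suc e) _ = ≤-trans (≤-reflexive (sym (*-identityʳ (suc a)))) (*-monoʳ-≤ (suc a) (^-positive (suc a) e (s≤s z≤n)))

  ^-suc-right : ∀ a e → a ^ e * a ≡ a ^ (e + 1)
  ^-suc-right a e = trans (cong (a ^ e *_) (sym (*-identityʳ a))) (sym (^-distribˡ-+-* a e 1))

  -- The numerical core of the extension step, with p = x m₁ and q = m₁ + 1: if every bad
  -- extension count B is at most (q/p)^m₁ A X and A ≤ (p/q)^m₁ x/q, then x X ≤ Y + B forces p X ≤ q Y.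
  extension-step : ∀ x Δ X Y B A m₁ →
    (Δ + x) * X ≤ Y + Δ * X + B →
    (x * m₁) ^ m₁ * B ≤ A * (suc m₁ ^ m₁ * X) →
    A * suc m₁ ^ suc m₁ ≤ x ^ suc m₁ * m₁ ^ m₁ →
    1 ≤ x → 1 ≤ m₁ → x * m₁ * X ≤ suc m₁ * Y
  extension-step x Δ X Y B A m₁ counted bad-bound A-bound x≥1 m₁≥1 = *-cancelˡ-≤ P {{P≢0}} cancelled
    where
    q = suc m₁
    P = (x * m₁) ^ m₁
    P≡ : P ≡ x ^ m₁ * m₁ ^ m₁
    P≡ = ^-distribʳ-* x m₁ m₁
    P≢0 : NonZero P
    P≢0 = >-nonZero (subst (1 ≤_) (sym P≡) (*-mono-≤ (^-positive x m₁ x≥1) (^-positive m₁ m₁ m₁≥1)))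
    xX≤Y+B : x * X ≤ Y + B
    xX≤Y+B = +-cancelˡ-≤ (Δ * X) _ _ (begin
        Δ * X + x * X      ≡⟨ sym (*-distribʳ-+ X Δ x) ⟩
        (Δ + x) * X        ≤⟨ counted ⟩
        Y + Δ * X + B      ≡⟨ rearrange Y (Δ * X) B ⟩
        Δ * X + (Y + B)    ∎)
      where
      open ≤-Reasoning
      rearrange : ∀ Y D B → Y + D + B ≡ D + (Y + B)
      rearrange = solve-∀
    PxX = P * (x * X)
    qPxX≤qPY+PxX : q * PxX ≤ q * (P * Y) + PxX
    qPxX≤qPY+PxX = begin
        q * (P * (x * X))              ≤⟨ *-monoʳ-≤ q (*-monoʳ-≤ P xX≤Y+B) ⟩
        q * (P * (Y + B))              ≡⟨ cong (q *_) (*-distribˡ-+ P Y B) ⟩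
        q * (P * Y + P * B)            ≡⟨ *-distribˡ-+ q (P * Y) (P * B) ⟩
        q * (P * Y) + q * (P * B)      ≤⟨ +-monoʳ-≤ (q * (P * Y)) (*-monoʳ-≤ q bad-bound) ⟩
        q * (P * Y) + q * (A * (q ^ m₁ * X))
                                       ≡⟨ cong (q * (P * Y) +_) (regroup q A (q ^ m₁) X) ⟩
        q * (P * Y) + A * q ^ suc m₁ * X
                                       ≤⟨ +-monoʳ-≤ (q * (P * Y)) (*-monoˡ-≤ X A-bound) ⟩
        q * (P * Y) + x ^ suc m₁ * m₁ ^ m₁ * X
                                       ≡⟨ cong (q * (P * Y) +_) (trans (regroup′ x (x ^ m₁) (m₁ ^ m₁) X) (cong (λ t → t * (x * X)) (sym P≡))) ⟩
        q * (P * Y) + PxX              ∎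
      where
      open ≤-Reasoning
      regroup : ∀ q A Q X → q * (A * (Q * X)) ≡ A * (q * Q) * X
      regroup = solve-∀
      regroup′ : ∀ x a b X → x * a * b * X ≡ a * b * (x * X)
      regroup′ = solve-∀
    cancelled : P * (x * m₁ * X) ≤ P * (q * Y)
    cancelled = begin
        P * (x * m₁ * X)    ≡⟨ regroup P x m₁ X ⟩
        m₁ * PxX            ≤⟨ +-cancelʳ-≤ PxX _ _ (≤-trans (≤-reflexive (+-comm (m₁ * PxX) PxX)) qPxX≤qPY+PxX) ⟩
        q * (P * Y)         ≡⟨ *-comm-middle q P Y ⟩
        P * (q * Y)         ∎
      where
      open ≤-Reasoning
      regroup : ∀ P x m X → P * (x * m * X) ≡ m * (P * (x * X))
      regroup = solve-∀
      *-comm-middle : ∀ q P Y → q * (P * Y) ≡ P * (q * Y)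
      *-comm-middle = solve-∀

  last-below : ∀ (f : ℕ → ℕ) U y → (∀ z → z ≤ f z) → f y ≤ U → ∃ λ z → y ≤ z × f z ≤ U × U < f (suc z)
  last-below f U y unbounded fy≤U = search (suc U) y fy≤U (m≤n+m (suc U) y)
    where
    search : ∀ fuel y → f y ≤ U → U < y + fuel → ∃ λ z → y ≤ z × f z ≤ U × U < f (suc z)
    search zero y fy≤U U<y = ⊥-elim (<-irrefl refl (≤-trans (s≤s (≤-trans (unbounded y) fy≤U)) (≤-trans U<y (≤-reflexive (+-identityʳ y)))))
    search (suc fuel) y fy≤U U<y+fuel with f (suc y) ≤? U
    ... | no ¬fsy≤U = y , ≤-refl , fy≤U , ≰⇒> ¬fsy≤U
    ... | yes fsy≤U with search fuel (suc y) fsy≤U (≤-trans U<y+fuel (≤-reflexive (+-suc y fuel)))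
    ...   | z , sy≤z , fz≤U , U<fsz = z , ≤-trans (n≤1+n y) sy≤z , fz≤U , U<fsz

  module Palette (m₁ k d : ℕ) (m₁≥1 : 1 ≤ m₁) (k≥1 : 1 ≤ k) where
    Δ = suc d
    M = suc m₁
    S = m₁ ^ m₁

    f : ℕ → ℕ
    f y = y ^ M * S

    U L : ℕ
    U = M ^ M * k * Δ ^ (M + 1)
    L = k * (Δ * d ^ M) * M ^ M

    f-unbounded : ∀ y → y ≤ f y
    f-unbounded y = ≤-trans (m≤m^n y M (s≤s z≤n)) (m≤m*n (y ^ M) S {{>-nonZero (^-positive m₁ m₁ m₁≥1)}})

    SΔ^M≤U : S * Δ ^ M ≤ U
    SΔ^M≤U = begin
        S * Δ ^ M                ≤⟨ *-monoˡ-≤ (Δ ^ M) (≤-trans (^-monoˡ-≤ m₁ (n≤1+n m₁)) (^-monoʳ-≤ M (n≤1+n m₁))) ⟩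
        M ^ M * Δ ^ M            ≤⟨ *-monoˡ-≤ (Δ ^ M) (m≤m*n (M ^ M) k {{>-nonZero k≥1}}) ⟩
        M ^ M * k * Δ ^ M        ≤⟨ *-monoʳ-≤ (M ^ M * k) (m≤m*n (Δ ^ M) Δ) ⟩
        M ^ M * k * (Δ ^ M * Δ)  ≡⟨ cong (M ^ M * k *_) (^-suc-right Δ M) ⟩
        U                        ∎
      where open ≤-Reasoning

    f1≤U : f 1 ≤ U
    f1≤U = ≤-trans (≤-reflexive (trans (cong (_* S) (^-zeroˡ M)) (*-identityˡ S)))
                   (≤-trans (m≤m*n S (Δ ^ M) {{m^n≢0 Δ M}}) SΔ^M≤U)

    f[1+z]≤U : ∀ z → z < Δ → f (suc z) ≤ U
    f[1+z]≤U z z<Δ = begin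
        suc z ^ M * S      ≤⟨ *-monoˡ-≤ S (^-monoˡ-≤ M z<Δ) ⟩
        Δ ^ M * S          ≡⟨ *-comm (Δ ^ M) S ⟩
        S * Δ ^ M          ≤⟨ SΔ^M≤U ⟩
        U                  ∎
      where open ≤-Reasoning

    f[1+z]<U : ∀ z → d ≤ z → f z < L → f (suc z) < U
    f[1+z]<U z d≤z fz<L = *-cancelʳ-< (d ^ M) _ _ (begin-strict
        suc z ^ M * S * d ^ M       ≡⟨ swap₂₃ (suc z ^ M) S (d ^ M) ⟩
        suc z ^ M * d ^ M * S       ≡⟨ cong (_* S) (sym (^-distribʳ-* (suc z) d M)) ⟩
        (suc z * d) ^ M * S         ≤⟨ *-monoˡ-≤ S (^-monoˡ-≤ M sz*d≤z*Δ) ⟩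
        (z * Δ) ^ M * S             ≡⟨ cong (_* S) (^-distribʳ-* z Δ M) ⟩
        z ^ M * Δ ^ M * S           ≡⟨ swap₂₃ (z ^ M) (Δ ^ M) S ⟩
        z ^ M * S * Δ ^ M           <⟨ *-monoˡ-< (Δ ^ M) {{m^n≢0 Δ M}} fz<L ⟩
        L * Δ ^ M                   ≡⟨ regroup k Δ (d ^ M) (M ^ M) (Δ ^ M) ⟩
        M ^ M * k * (Δ ^ M * Δ) * d ^ M
                                    ≡⟨ cong (λ t → M ^ M * k * t * d ^ M) (^-suc-right Δ M) ⟩
        U * d ^ M                   ∎)
      where
      open ≤-Reasoning
      sz*d≤z*Δ : suc z * d ≤ z * Δ
      sz*d≤z*Δ = begin
          d + z * d   ≤⟨ +-monoˡ-≤ (z * d) d≤z ⟩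
          z + z * d   ≡⟨ sym (*-suc z d) ⟩
          z * Δ       ∎
      swap₂₃ : ∀ a b c → a * b * c ≡ a * c * b
      swap₂₃ = solve-∀
      regroup : ∀ k Δ D Q P → k * (Δ * D) * Q * P ≡ Q * k * (P * Δ) * D
      regroup = solve-∀

    excess : ∃ λ x → 1 ≤ x × f x ≤ U × L ≤ f x
    excess with last-below f U 1 f-unbounded f1≤U
    ... | z , 1≤z , fz≤U , U<fsz = z , 1≤z , fz≤U , L≤fz
      where
      L≤fz : L ≤ f z
      L≤fz with L ≤? f z | d ≤? z
      ... | yes L≤fz | _       = L≤fz
      ... | no L≰fz  | yes d≤z = ⊥-elim (<-asym U<fsz (f[1+z]<U z d≤z (≰⇒> L≰fz)))
      ... | no _     | no d≰z  = ⊥-elim (<⇒≱ U<fsz (f[1+z]≤U z (s≤s (<⇒≤ (≰⇒> d≰z)))))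

  -- x ≈ C_m k^(1/m) Δ^((m+1)/m) is the largest integer with x^m (m-1)^(m-1) ≤ m^m k Δ^(m+1).
  palette-excess : ∀ m₁ k Δ → 1 ≤ m₁ → 1 ≤ k → 1 ≤ Δ → ∃ λ x → 1 ≤ x
    × x ^ suc m₁ * m₁ ^ m₁ ≤ suc m₁ ^ suc m₁ * k * Δ ^ (suc m₁ + 1)
    × k * (Δ * (Δ ∸ 1) ^ suc m₁) * suc m₁ ^ suc m₁ ≤ x ^ suc m₁ * m₁ ^ m₁
  palette-excess m₁ k (suc d) m₁≥1 k≥1 _ = Palette.excess m₁ k d m₁≥1 k≥1

  2k∸1≡1+[2k∸2] : ∀ k → 2 ≤ k → 2 * k ∸ 1 ≡ suc (2 * k ∸ 2)
  2k∸1≡1+[2k∸2] (suc (suc k)) _ = refl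
  2k∸1≡1+[2k∸2] (suc zero) (s≤s ())

  2≤2k∸2 : ∀ k → 2 ≤ k → 2 ≤ 2 * k ∸ 2
  2≤2k∸2 (suc (suc k)) _ = ≤-trans (s≤s (s≤s z≤n)) (m≤n+m (suc (suc (k + 0))) k)
  2≤2k∸2 (suc zero) (s≤s ())

  n+n≢1+m+m : ∀ a b → a + a ≢ suc (b + b)
  n+n≢1+m+m zero    b       ()
  n+n≢1+m+m (suc a) zero    e with trans (sym (+-suc a a)) (suc-injective e)
  ... | ()
  n+n≢1+m+m (suc a) (suc b) e =
    n+n≢1+m+m a b (suc-injective (trans (sym (+-suc a a)) (trans (suc-injective e) (cong suc (+-suc b b)))))

  2k∸1-odd : ∀ k j → 2 ≤ k → j + j ≢ 2 * k ∸ 1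
  2k∸1-odd (suc zero) j (s≤s ())
  2k∸1-odd (suc (suc k)) j _ e =
    n+n≢1+m+m j (suc k) (trans e (cong suc (trans (+-suc k (suc (k + 0))) (cong (λ t → suc (k + suc t)) (+-identityʳ k)))))

  2k∸2≡1+[2k∸3] : ∀ k → 2 ≤ k → 2 * k ∸ 2 ≡ suc (2 * k ∸ 3)
  2k∸2≡1+[2k∸3] k k≥2 = begin
      2 * k ∸ 2                ≡⟨ sym (suc-pred (2 * k ∸ 2) {{>-nonZero (≤-trans (s≤s z≤n) (2≤2k∸2 k k≥2))}}) ⟩
      suc (pred (2 * k ∸ 2))   ≡⟨ cong suc (pred[m∸n]≡m∸[1+n] (2 * k) 2) ⟩
      suc (2 * k ∸ 3)          ∎
    where open ≡-Reasoning

  1≤m₁ : ∀ k m₁ → 2 ≤ k → 2 * k ∸ 2 ≡ suc m₁ → 1 ≤ m₁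
  1≤m₁ k m₁ k≥2 m≡1+m₁ = ≤-pred (subst (2 ≤_) m≡1+m₁ (2≤2k∸2 k k≥2))

module Extension {n : ℕ} (G : Graph n) (k N Δ : ℕ) (maxdeg : ∀ v → degree G v ≤ Δ) (k≥2 : 2 ≤ k) where
  open Sums
  open Windows
  open VertexLists n
  open PartialColourings N
  open Neighbourhoods G
  open GoodColourings G k N
  open NonBacktrackingWalks G Δ maxdeg
  open Arms k
  open Arithmetic
  open DecMembership (_≟_ {n}) using (_∈?_)

  HeadsAgree : Colouring → List (Fin n) → List (Fin n) → Set
  HeadsAgree h (a ∷ _) (b ∷ _) = lookup h a ≡ lookup h b
  HeadsAgree h _       _       = ⊤

  HeadsAgree-swap : ∀ h A B → HeadsAgree h A B → HeadsAgree h B A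
  HeadsAgree-swap h []      []      _ = tt
  HeadsAgree-swap h []      (b ∷ B) _ = tt
  HeadsAgree-swap h (a ∷ A) []      _ = tt
  HeadsAgree-swap h (a ∷ A) (b ∷ B) e = sym e

  -- The bicoloured path reverse A ++ v ∷ B seen from v as two arms; HeadsAgree is the alternation across v.
  BicolouredArms : Colouring → Fin n → List (Fin n) → List (Fin n) → Set
  BicolouredArms h v A B = Chain Adj (v ∷ A) × Chain Adj (v ∷ B) × Distinct (v ∷ A ++ B)
    × All (Coloured h) (A ++ B) × Alternating h (v ∷ A) × Alternating h (v ∷ B) × HeadsAgree h A B

  BicolouredArms-swap : ∀ h v A B → BicolouredArms h v A B → BicolouredArms h v B A
  BicolouredArms-swap h v A B (cA , cB , d , cs , aA , aB , heads) =
    cB , cA , Distinct-fewer (v ∷ B ++ A) (v ∷ A ++ B) (λ y → ≤-reflexive (cong (𝟙 (y ≟ v) +_) (occ-++-comm y B A))) d ,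
    All.++⁺ (All.++⁻ʳ A cs) (All.++⁻ˡ A cs) , aB , aA , HeadsAgree-swap h A B heads

  reverse-reverse-++-∷ : ∀ (A : List (Fin n)) v B → reverse (reverse A ++ v ∷ B) ≡ reverse B ++ v ∷ A
  reverse-reverse-++-∷ A v B = begin
      reverse (reverse A ++ v ∷ B)             ≡⟨ reverse-++ (reverse A) (v ∷ B) ⟩
      reverse (v ∷ B) ++ reverse (reverse A)   ≡⟨ cong₂ _++_ (unfold-reverse v B) (reverse-involutive A) ⟩
      (reverse B ∷ʳ v) ++ A                    ≡⟨ ++-assoc (reverse B) [ v ] A ⟩
      reverse B ++ v ∷ A                       ∎
    where open ≡-Reasoning

  Alternating⇒HeadsAgree : ∀ h v A B → Alternating h (reverse A ++ v ∷ B) → HeadsAgree h A B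
  Alternating⇒HeadsAgree h v []      B       _ = tt
  Alternating⇒HeadsAgree h v (a ∷ A) []      _ = tt
  Alternating⇒HeadsAgree h v (a ∷ A) (b ∷ B) alt = Chain₃-at (reverse A) a v b B (subst (Alternating h) split alt)
    where
    split : reverse (a ∷ A) ++ v ∷ b ∷ B ≡ reverse A ++ a ∷ v ∷ b ∷ B
    split = trans (cong (_++ v ∷ b ∷ B) (unfold-reverse a A)) (++-assoc (reverse A) [ a ] (v ∷ b ∷ B))

  BicolouredPath⇒Arms : ∀ h v A B → BicolouredPath h (reverse A ++ v ∷ B) → BicolouredArms h v A B
  BicolouredPath⇒Arms h v A B (c , d , cs , alt) =
    Chain-map Adj-sym (v ∷ A)
      (Chain-suffix (reverse B) (v ∷ A) (subst (Chain (flip Adj)) (reverse-reverse-++-∷ A v B) (Chain-reverse (reverse A ++ v ∷ B) c))) ,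
    Chain-suffix (reverse A) (v ∷ B) c ,
    Distinct-fewer (v ∷ A ++ B) (reverse A ++ v ∷ B) (λ y → ≤-reflexive (occ-centre y)) d ,
    All.++⁺ (subst (All (Coloured h)) (reverse-involutive A) (All-reverse (reverse A) (All.++⁻ˡ (reverse A) cs)))
            (All.tail (All.++⁻ʳ (reverse A) cs)) ,
    Chain₃-map sym (v ∷ A)
      (Chain₃-suffix (reverse B) (v ∷ A)
        (subst (Chain₃ (λ x _ z → lookup h z ≡ lookup h x)) (reverse-reverse-++-∷ A v B) (Chain₃-reverse (reverse A ++ v ∷ B) alt))) ,
    Chain₃-suffix (reverse A) (v ∷ B) alt ,
    Alternating⇒HeadsAgree h v A B alt
    where
    occ-centre : ∀ y → occ y (v ∷ A ++ B) ≡ occ y (reverse A ++ v ∷ B)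
    occ-centre y = begin
        𝟙 (y ≟ v) + occ y (A ++ B)                 ≡⟨ cong (𝟙 (y ≟ v) +_) (occ-++ y A B) ⟩
        𝟙 (y ≟ v) + (occ y A + occ y B)            ≡⟨ swap (𝟙 (y ≟ v)) (occ y A) (occ y B) ⟩
        occ y A + (𝟙 (y ≟ v) + occ y B)            ≡⟨ cong (_+ occ y (v ∷ B)) (sym (occ-reverse y A)) ⟩
        occ y (reverse A) + occ y (v ∷ B)          ≡⟨ sym (occ-++ y (reverse A) (v ∷ B)) ⟩
        occ y (reverse A ++ v ∷ B)                 ∎
      where
      open ≡-Reasoning
      swap : ∀ a b c → a + (b + c) ≡ b + (a + c)
      swap = solve-∀

  Repeats : Colouring → Fin n → Fin n → List (Fin n) → Set
  Repeats g a b []       = ⊤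
  Repeats g a b (y ∷ ys) = lookup g y ≡ lookup g a × Repeats g b a ys

  ArmsIn : Vec Bool n → Fin n → List (Fin n) → List (Fin n) → Set
  ArmsIn S v A B = length A + length B ≡ 2 * k ∸ 1 × Distinct (v ∷ A ++ B) × All (_∈ˢ S) (A ++ B)

  -- Colouring v with c completes a bicoloured path reverse A ++ v ∷ a ∷ b ∷ rs: then b has colour c
  -- and the colours of all other vertices of the path repeat those of a and b.
  PatternWith : Colouring → Fin N → List (Fin n) → List (Fin n) → Set
  PatternWith g c A (a ∷ b ∷ rs) = lookup g b ≡ just c × Coloured g a × Repeats g a b A × Repeats g a b rs
  PatternWith g c A _            = ⊥

  Pattern : Colouring → List (Fin n) → List (Fin n) → Set
  Pattern g A (a ∷ b ∷ rs) = Coloured g a × Coloured g b × Repeats g a b A × Repeats g a b rs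
  Pattern g A _            = ⊥

  BadExtension : Vec Bool n → Fin n → Colouring → Fin N → List (Fin n) → List (Fin n) → Set
  BadExtension S v g c A B = ArmsIn S v A B × Good g × PatternWith g c A B

  BadPattern : Vec Bool n → Fin n → Colouring → List (Fin n) → List (Fin n) → Set
  BadPattern S v g A B = ArmsIn S v A B × Good g × Pattern g A B

  opaque
    Repeats? : ∀ g a b ys → Dec (Repeats g a b ys)
    Repeats? g a b []       = yes tt
    Repeats? g a b (y ∷ ys) = (lookup g y ≟ᶜ lookup g a) ×-dec Repeats? g b a ys

    ArmsIn? : ∀ S v A B → Dec (ArmsIn S v A B)
    ArmsIn? S v A B = (length A + length B ℕ.≟ 2 * k ∸ 1) ×-dec
      (Distinct? (v ∷ A ++ B) ×-dec All.all? (λ u → lookup S u Bool.≟ true) (A ++ B))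

    PatternWith? : ∀ g c A B → Dec (PatternWith g c A B)
    PatternWith? g c A []           = no λ ()
    PatternWith? g c A (a ∷ [])     = no λ ()
    PatternWith? g c A (a ∷ b ∷ rs) =
      (lookup g b ≟ᶜ just c) ×-dec (Coloured? g a ×-dec (Repeats? g a b A ×-dec Repeats? g a b rs))

    Pattern? : ∀ g A B → Dec (Pattern g A B)
    Pattern? g A []           = no λ ()
    Pattern? g A (a ∷ [])     = no λ ()
    Pattern? g A (a ∷ b ∷ rs) = Coloured? g a ×-dec (Coloured? g b ×-dec (Repeats? g a b A ×-dec Repeats? g a b rs))

    BadExtension? : ∀ S v g c A B → Dec (BadExtension S v g c A B)
    BadExtension? S v g c A B = ArmsIn? S v A B ×-dec (Good? g ×-dec PatternWith? g c A B)

    BadPattern? : ∀ S v g A B → Dec (BadPattern S v g A B)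
    BadPattern? S v g A B = ArmsIn? S v A B ×-dec (Good? g ×-dec Pattern? g A B)

  PatternWith⇒Pattern : ∀ g c A B → PatternWith g c A B → Pattern g A B
  PatternWith⇒Pattern g c A (a ∷ b ∷ rs) (gb , ca , rA , rrs) = ca , (c , gb) , rA , rrs

  ∑Fin-BadExtension : ∀ S v g A B → ∑Fin N (λ c → 𝟙 (BadExtension? S v g c A B)) ≤ 𝟙 (BadPattern? S v g A B)
  ∑Fin-BadExtension S v g A B with BadPattern? S v g A B
  ... | no ¬bad = ≤-reflexive (trans (∑Fin-cong N λ c → 𝟙-no (BadExtension? S v g c A B)
                    (λ (arms , good , pat) → ¬bad (arms , good , PatternWith⇒Pattern g c A B pat))) (∑Fin-0 N))
  ... | yes (_ , _ , pat) = at-most-one B pat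
    where
    at-most-one : ∀ B → Pattern g A B → ∑Fin N (λ c → 𝟙 (BadExtension? S v g c A B)) ≤ 1
    at-most-one (a ∷ b ∷ rs) _ =
      ∑Fin-𝟙≤1-just N (lookup g b) (λ c → BadExtension? S v g c A (a ∷ b ∷ rs)) (λ c (_ , _ , gb , _) → gb)

  Alternating⇒Repeats : ∀ h a b a′ b′ xs → Alternating h (a′ ∷ b′ ∷ xs) →
    lookup h a′ ≡ lookup h a → lookup h b′ ≡ lookup h b → Repeats h a b xs
  Alternating⇒Repeats h a b a′ b′ []       _       _   _   = tt
  Alternating⇒Repeats h a b a′ b′ (y ∷ xs) (e , alt) a′≡a b′≡b =
    trans (sym e) a′≡a , Alternating⇒Repeats h b a b′ y xs alt b′≡b (trans (sym e) a′≡a)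

  Repeats-transport : ∀ h g a b xs → lookup h a ≡ lookup g a → lookup h b ≡ lookup g b →
    All (λ u → lookup h u ≡ lookup g u) xs → Repeats h a b xs → Repeats g a b xs
  Repeats-transport h g a b []       _   _   _            _         = tt
  Repeats-transport h g a b (y ∷ xs) ha hb (hy ∷ agree) (e , rep) =
    trans (sym hy) (trans e ha) , Repeats-transport h g b a xs hb ha agree rep

  Coloured⇒∈ˢ : ∀ S g v c xs → Domain S g → v ∉ xs → All (Coloured (g [ v ]≔ just c)) xs → All (_∈ˢ S) xs
  Coloured⇒∈ˢ S g v c []       _   _  _          = []
  Coloured⇒∈ˢ S g v c (y ∷ xs) dom v∉ (cy ∷ cs) with Coloured-unset g v c (λ e → v∉ (here (sym e))) cy
  ... | d , e = Domain-∈ dom y d e ∷ Coloured⇒∈ˢ S g v c xs dom (v∉ ∘ there) cs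

  shorter-arm<k : ∀ j b → j < b → j + b ≡ 2 * k ∸ 1 → j < k
  shorter-arm<k j b j<b e with j <? k
  ... | yes j<k = j<k
  ... | no j≮k = ⊥-elim (<-irrefl refl (begin-strict
        2 * k ∸ 1    ≤⟨ m∸n≤m (2 * k) 1 ⟩
        k + (k + 0)  ≡⟨ cong (k +_) (+-identityʳ k) ⟩
        k + k        ≤⟨ +-mono-≤ (≮⇒≥ j≮k) (≮⇒≥ j≮k) ⟩
        j + j        <⟨ +-monoʳ-< j j<b ⟩
        j + b        ≡⟨ e ⟩
        2 * k ∸ 1    ∎))
    where open ≤-Reasoning

  BicolouredArms⇒BadExtension : ∀ S v g c A a b rs → Good g → Domain S g →
    BicolouredArms (g [ v ]≔ just c) v A (a ∷ b ∷ rs) → length A + length (a ∷ b ∷ rs) ≡ 2 * k ∸ 1 →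
    BadExtension S v g c A (a ∷ b ∷ rs)
  BicolouredArms⇒BadExtension S v g c A a b rs good dom (_ , _ , d , cs , altA , altB , heads) len =
    (len , d , Coloured⇒∈ˢ S g v c (A ++ B) dom v∉ cs) , good ,
    trans (sym gb) (trans (sym vb) (lookup∘update v g (just c))) ,
    Coloured-unset g v c (λ e → v∉B (here (sym e))) (All.head (All.++⁻ʳ A cs)) ,
    Repeats-transport h g a b A ga gb (≔-unchanged-on g v c A v∉A) (repeats-left A heads altA) ,
    Repeats-transport h g a b rs ga gb (All.tail (All.tail (≔-unchanged-on g v c B v∉B)))
      (Alternating⇒Repeats h a b a b rs (proj₂ altB) refl refl)
    where
    h = g [ v ]≔ just c
    B = a ∷ b ∷ rs
    v∉ : v ∉ A ++ B
    v∉ = Distinct-head d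
    v∉A : v ∉ A
    v∉A = v∉ ∘ ∈-++⁺ˡ
    v∉B : v ∉ B
    v∉B = v∉ ∘ ∈-++⁺ʳ A
    ga : lookup h a ≡ lookup g a
    ga = lookup∘update′ (λ e → v∉B (here (sym e))) g (just c)
    gb : lookup h b ≡ lookup g b
    gb = lookup∘update′ (λ e → v∉B (there (here (sym e)))) g (just c)
    vb : lookup h v ≡ lookup h b
    vb = proj₁ altB
    repeats-left : ∀ A → HeadsAgree h A B → Alternating h (v ∷ A) → Repeats h a b A
    repeats-left []       _  _   = tt
    repeats-left (x ∷ A′) xa alt = xa , Alternating⇒Repeats h b a v x A′ alt vb xa

  BicolouredArms⇒∑Arms-< : ∀ S v g c A B → Good g → Domain S g → BicolouredArms (g [ v ]≔ just c) v A B →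
    length A < length B → length A + length B ≡ 2 * k ∸ 1 → 1 ≤ ∑Arms v (λ A B → 𝟙 (BadExtension? S v g c A B))
  BicolouredArms⇒∑Arms-< S v g c []      (a ∷ [])     _ _ _ _ len =
    ⊥-elim (2≰0 (subst (2 ≤_) (sym (suc-injective (trans len (2k∸1≡1+[2k∸2] k k≥2)))) (2≤2k∸2 k k≥2)))
    where
    2≰0 : ¬ 2 ≤ 0
    2≰0 ()
  BicolouredArms⇒∑Arms-< S v g c (_ ∷ _) (a ∷ [])     _ _ _ (s≤s ()) _
  BicolouredArms⇒∑Arms-< S v g c A       (a ∷ b ∷ rs) good dom arms@(cA , cB , d , _) A<B len =
    ≤-trans (≤-reflexive (sym (𝟙-yes (BadExtension? S v g c A (a ∷ b ∷ rs))
              (BicolouredArms⇒BadExtension S v g c A a b rs good dom arms len))))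
      (∑Arms-≥ v (λ A B → 𝟙 (BadExtension? S v g c A B)) j (∈-nbrs (proj₁ cB))
        (Path⇒Walk v a (b ∷ rs) (proj₂ cB) d₁) right-length (Path⇒Walk a v A cA d₂) (sym (Fin.toℕ-fromℕ< j<k)))
    where
    B = a ∷ b ∷ rs
    j<k : length A < k
    j<k = shorter-arm<k (length A) (length B) A<B len
    j = Data.Fin.fromℕ< j<k
    d₁ : Distinct (v ∷ B)
    d₁ = Distinct-∷-++⁻ʳ v A B d
    d₂ : Distinct (a ∷ v ∷ A)
    d₂ = Distinct-fewer (a ∷ v ∷ A) (v ∷ A ++ B) fewer d
      where
      fewer : ∀ y → occ y (a ∷ v ∷ A) ≤ occ y (v ∷ A ++ B)
      fewer y = begin
          𝟙 (y ≟ a) + (𝟙 (y ≟ v) + occ y A)                         ≤⟨ ≤-reflexive (rotate (𝟙 (y ≟ a)) (𝟙 (y ≟ v)) (occ y A)) ⟩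
          𝟙 (y ≟ v) + (occ y A + 𝟙 (y ≟ a))                         ≤⟨ +-monoʳ-≤ (𝟙 (y ≟ v)) (+-monoʳ-≤ (occ y A) (m≤m+n _ _)) ⟩
          𝟙 (y ≟ v) + (occ y A + occ y B)                           ≡⟨ cong (𝟙 (y ≟ v) +_) (sym (occ-++ y A B)) ⟩
          occ y (v ∷ A ++ B)                                        ∎
        where
        open ≤-Reasoning
        rotate : ∀ p q r → p + (q + r) ≡ q + (r + p)
        rotate = solve-∀
    right-length : length (b ∷ rs) ≡ m ∸ toℕ j
    right-length = sym (begin
        m ∸ toℕ j                          ≡⟨ cong (m ∸_) (Fin.toℕ-fromℕ< j<k) ⟩
        m ∸ length A                       ≡⟨ cong (_∸ length A) (suc-injective (begin
                                                suc m                                ≡⟨ sym (2k∸1≡1+[2k∸2] k k≥2) ⟩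
                                                2 * k ∸ 1                            ≡⟨ sym len ⟩
                                                length A + suc (length (b ∷ rs))     ≡⟨ +-suc (length A) _ ⟩
                                                suc (length A + length (b ∷ rs))     ∎)) ⟩
        length A + length (b ∷ rs) ∸ length A ≡⟨ m+n∸m≡n (length A) _ ⟩
        length (b ∷ rs)                    ∎)
      where open ≡-Reasoning

  NeighbourHas : Colouring → Fin n → Fin N → Set
  NeighbourHas g v c = Any (λ u → lookup g u ≡ just c) (nbrs v)

  opaque
    NeighbourHas? : ∀ g v c → Dec (NeighbourHas g v c)
    NeighbourHas? g v c = Any.any? (λ u → lookup g u ≟ᶜ just c) (nbrs v)

  NoClash? : ∀ h u w → Dec (Adj u w → ¬ Clash h u w)
  NoClash? h u w = Adj? u w →-dec ¬? (Coloured? h u ×-dec (lookup h u ≟ᶜ lookup h w))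

  ¬ProperPartial⇒Clash : ∀ h → ¬ ProperPartial h → ∃ λ u → ∃ λ w → Adj u w × Clash h u w
  ¬ProperPartial⇒Clash h ¬proper with Fin.¬∀⟶∃¬ n _ (λ u → Fin.all? (NoClash? h u)) ¬proper
  ... | u , ¬u with Fin.¬∀⟶∃¬ n _ (NoClash? h u) ¬u
  ...   | w , ¬w with Adj? u w | Coloured? h u ×-dec (lookup h u ≟ᶜ lookup h w)
  ...     | yes a | yes cl = u , w , a , cl
  ...     | yes a | no ¬cl = ⊥-elim (¬w (λ _ → ¬cl))
  ...     | no ¬a | _      = ⊥-elim (¬w (⊥-elim ∘ ¬a))

  improper⇒NeighbourHas : ∀ v g c → Good g → ¬ ProperPartial (g [ v ]≔ just c) → NeighbourHas g v c
  improper⇒NeighbourHas v g c (proper , _) ¬proper with ¬ProperPartial⇒Clash (g [ v ]≔ just c) ¬proper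
  ... | u , w , a , (cu , e) with u ≟ v | w ≟ v
  ...   | yes refl | yes refl = ⊥-elim (true≢false (trans (sym a) (irrefl G v)))
    where
    true≢false : true ≢ false
    true≢false ()
  ...   | yes refl | no w≢v = lose (∈-nbrs a) (trans (sym (lookup∘update′ w≢v g (just c))) (trans (sym e) (lookup∘update v g (just c))))
  ...   | no u≢v | yes refl = lose (∈-nbrs (Adj-sym a)) (trans (sym (lookup∘update′ u≢v g (just c))) (trans e (lookup∘update v g (just c))))
  ...   | no u≢v | no w≢v =
    ⊥-elim (proper u w a (Coloured-unset g v c u≢v cu ,
                          trans (sym (lookup∘update′ u≢v g (just c))) (trans e (lookup∘update′ w≢v g (just c)))))

  BicolouredArms⇒∑Arms : ∀ S v g c A B → Good g → Domain S g → BicolouredArms (g [ v ]≔ just c) v A B →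
    length A + length B ≡ 2 * k ∸ 1 → 1 ≤ ∑Arms v (λ A B → 𝟙 (BadExtension? S v g c A B))
  BicolouredArms⇒∑Arms S v g c A B good dom arms len with <-cmp (length A) (length B)
  ... | tri< A<B _ _ = BicolouredArms⇒∑Arms-< S v g c A B good dom arms A<B len
  ... | tri> _ _ B<A = BicolouredArms⇒∑Arms-< S v g c B A good dom (BicolouredArms-swap (g [ v ]≔ just c) v A B arms) B<A
                         (trans (+-comm (length B) (length A)) len)
  ... | tri≈ _ A≡B _ = ⊥-elim (2k∸1-odd k (length A) k≥2 (trans (cong (length A +_) A≡B) len))

  BicolouredPath⇒∑Arms : ∀ S v g c → Good g → Domain S g → ∀ Q → length Q ≡ 2 * k →
    BicolouredPath (g [ v ]≔ just c) Q → 1 ≤ ∑Arms v (λ A B → 𝟙 (BadExtension? S v g c A B))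
  BicolouredPath⇒∑Arms S v g c good dom Q len bad with v ∈? Q
  ... | no v∉Q = ⊥-elim (AllOfLength-apply (2 * k) (proj₂ good) Q len
                          (BicolouredPath-transport (g [ v ]≔ just c) g Q (≔-unchanged-on g v c Q v∉Q) bad))
  ... | yes v∈Q with ∈-∃++ v∈Q
  ...   | pre , post , refl =
    BicolouredArms⇒∑Arms S v g c (reverse pre) post good dom (BicolouredPath⇒Arms (g [ v ]≔ just c) v (reverse pre) post centred) lengths
    where
    centred : BicolouredPath (g [ v ]≔ just c) (reverse (reverse pre) ++ v ∷ post)
    centred = subst (λ t → BicolouredPath (g [ v ]≔ just c) (t ++ v ∷ post)) (sym (reverse-involutive pre)) bad
    lengths : length (reverse pre) + length post ≡ 2 * k ∸ 1
    lengths = begin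
        length (reverse pre) + length post      ≡⟨ cong (_+ length post) (length-reverse pre) ⟩
        length pre + length post                ≡⟨ cong (_∸ 1) (sym (+-suc (length pre) (length post))) ⟩
        length pre + length (v ∷ post) ∸ 1      ≡⟨ cong (_∸ 1) (sym (length-++ pre)) ⟩
        length (pre ++ v ∷ post) ∸ 1            ≡⟨ cong (_∸ 1) len ⟩
        2 * k ∸ 1                               ∎
      where open ≡-Reasoning

  colour-outcome : ∀ S v g c → Good g → Domain S g →
    1 ≤ 𝟙 (Good? (g [ v ]≔ just c)) + 𝟙 (NeighbourHas? g v c) + ∑Arms v (λ A B → 𝟙 (BadExtension? S v g c A B))
  colour-outcome S v g c good dom with Good? (g [ v ]≔ just c)
  ... | yes _ = s≤s z≤n
  ... | no ¬good with ProperPartial? (g [ v ]≔ just c)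
  ...   | no ¬proper =
    ≤-trans (≤-reflexive (sym (𝟙-yes (NeighbourHas? g v c) (improper⇒NeighbourHas v g c good ¬proper)))) (m≤m+n _ _)
  ...   | yes proper with ¬AllOfLength¬ (2 * k) (BicolouredPath? (g [ v ]≔ just c)) (λ none → ¬good (proper , none))
  ...     | Q , len , bad = ≤-trans (BicolouredPath⇒∑Arms S v g c good dom Q len bad) (m≤n+m _ _)

  ∑Fin-NeighbourHas : ∀ g v → ∑Fin N (λ c → 𝟙 (NeighbourHas? g v c)) ≤ Δ
  ∑Fin-NeighbourHas g v = begin
      ∑Fin N (λ c → 𝟙 (NeighbourHas? g v c))
    ≤⟨ ∑Fin-mono N (λ c → union-bound (λ u → lookup g u ≟ᶜ just c) (nbrs v) (NeighbourHas? g v c)) ⟩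
      ∑Fin N (λ c → ∑List (nbrs v) (λ u → 𝟙 (lookup g u ≟ᶜ just c)))
    ≡⟨ sym (∑List-∑ (∑Fin-summation N) (nbrs v) (λ u c → 𝟙 (lookup g u ≟ᶜ just c))) ⟩
      ∑List (nbrs v) (λ u → ∑Fin N (λ c → 𝟙 (lookup g u ≟ᶜ just c)))
    ≤⟨ ∑List-≤-* (nbrs v) (λ u _ → ∑Fin-𝟙≤1-just N (lookup g u) (λ c → lookup g u ≟ᶜ just c) (λ c e → e)) ⟩
      length (nbrs v) * 1
    ≡⟨ *-identityʳ _ ⟩
      degree G v
    ≤⟨ maxdeg v ⟩
      Δ ∎
    where open ≤-Reasoning

  extension-count-at : ∀ S v g → Domain S g → N * 𝟙 (Good? g) ≤
    ∑Fin N (λ c → 𝟙 (Good? (g [ v ]≔ just c))) + Δ * 𝟙 (Good? g) + ∑Arms v (λ A B → 𝟙 (BadPattern? S v g A B))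
  extension-count-at S v g dom with Good? g
  ... | no _ = ≤-trans (≤-reflexive (*-zeroʳ N)) z≤n
  ... | yes good = begin
      N * 1
    ≡⟨ sym (∑Fin-const N 1) ⟩
      ∑Fin N (λ _ → 1)
    ≤⟨ ∑Fin-mono N (λ c → colour-outcome S v g c good dom) ⟩
      ∑Fin N (λ c → Y c + 𝟙 (NeighbourHas? g v c) + bad c)
    ≡⟨ trans (∑Fin-+ N _ bad) (cong (_+ ∑Fin N bad) (∑Fin-+ N Y _)) ⟩
      ∑Fin N Y + ∑Fin N (λ c → 𝟙 (NeighbourHas? g v c)) + ∑Fin N bad
    ≤⟨ +-mono-≤ (+-monoʳ-≤ (∑Fin N Y) (≤-trans (∑Fin-NeighbourHas g v) (≤-reflexive (sym (*-identityʳ Δ))))) bad-patterns ⟩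
      ∑Fin N Y + Δ * 1 + ∑Arms v (λ A B → 𝟙 (BadPattern? S v g A B)) ∎
    where
    open ≤-Reasoning
    Y : Fin N → ℕ
    Y c = 𝟙 (Good? (g [ v ]≔ just c))
    bad : Fin N → ℕ
    bad c = ∑Arms v (λ A B → 𝟙 (BadExtension? S v g c A B))
    bad-patterns : ∑Fin N bad ≤ ∑Arms v (λ A B → 𝟙 (BadPattern? S v g A B))
    bad-patterns = ≤-trans (≤-reflexive (sym (∑Arms-∑ (∑Fin-summation N) v (λ A B c → 𝟙 (BadExtension? S v g c A B)))))
                           (∑Arms-mono v (∑Fin-BadExtension S v g))

  extension-count : ∀ S v → lookup S v ≡ false →
    N * #Good S ≤ #Good (S [ v ]≔ true) + Δ * #Good S + ∑Arms v (λ A B → ∑Col S (λ g → 𝟙 (BadPattern? S v g A B)))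
  extension-count S v v∉S = begin
      N * #Good S
    ≡⟨ *-∑ (∑Col-summation S) N _ ⟩
      ∑Col S (λ g → N * 𝟙 (Good? g))
    ≤⟨ ∑Col-mono S (λ g dom → extension-count-at S v g dom) ⟩
      ∑Col S (λ g → Y g + Δ * 𝟙 (Good? g) + bad g)
    ≡⟨ trans (∑Col-+ S _ bad) (cong (_+ ∑Col S bad) (∑Col-+ S Y _)) ⟩
      ∑Col S Y + ∑Col S (λ g → Δ * 𝟙 (Good? g)) + ∑Col S bad
    ≡⟨ cong₂ _+_ (cong₂ _+_ (sym (∑Col-extend S v (𝟙 ∘ Good?) v∉S)) (sym (*-∑ (∑Col-summation S) Δ _)))
                 (sym (∑Arms-∑ (∑Col-summation S) v (λ A B g → 𝟙 (BadPattern? S v g A B)))) ⟩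
      #Good (S [ v ]≔ true) + Δ * #Good S + ∑Arms v (λ A B → ∑Col S (λ g → 𝟙 (BadPattern? S v g A B))) ∎
    where
    open ≤-Reasoning
    Y : Colouring → ℕ
    Y g = ∑Fin N (λ c → 𝟙 (Good? (g [ v ]≔ just c)))
    bad : Colouring → ℕ
    bad g = ∑Arms v (λ A B → 𝟙 (BadPattern? S v g A B))

module Peeling {n : ℕ} (G : Graph n) (k N : ℕ) where
  open Sums
  open VertexLists n
  open PartialColourings N
  open GoodColourings G k N

  _∖_ : Vec Bool n → List (Fin n) → Vec Bool n
  S ∖ []       = S
  S ∖ (w ∷ ws) = (S [ w ]≔ false) ∖ ws

  ∖-preserves-∉ : ∀ ws (S : Vec Bool n) u → lookup S u ≡ false → lookup (S ∖ ws) u ≡ false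
  ∖-preserves-∉ []       S u e = e
  ∖-preserves-∉ (w ∷ ws) S u e = ∖-preserves-∉ ws (S [ w ]≔ false) u removed
    where
    removed : lookup (S [ w ]≔ false) u ≡ false
    removed with u ≟ w
    ... | yes refl = lookup∘update u S false
    ... | no u≢w   = trans (lookup∘update′ u≢w S false) e

  ∖-removes : ∀ ws (S : Vec Bool n) u → u ∈ ws → lookup (S ∖ ws) u ≡ false
  ∖-removes (w ∷ ws) S u (here refl) = ∖-preserves-∉ ws (S [ u ]≔ false) u (lookup∘update u S false)
  ∖-removes (w ∷ ws) S u (there u∈) = ∖-removes ws (S [ w ]≔ false) u u∈

  ∈ˢ-remove : ∀ (S : Vec Bool n) w us → w ∉ us → All (_∈ˢ S) us → All (_∈ˢ (S [ w ]≔ false)) us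
  ∈ˢ-remove S w []       _  _         = []
  ∈ˢ-remove S w (u ∷ us) w∉ (u∈ ∷ us∈) =
    trans (lookup∘update′ (λ e → w∉ (here (sym e))) S false) u∈ ∷ ∈ˢ-remove S w us (w∉ ∘ there) us∈

  ≔-restore : ∀ (S : Vec Bool n) w → w ∈ˢ S → (S [ w ]≔ false) [ w ]≔ true ≡ S
  ≔-restore S w w∈ = trans ([]≔-idempotent S w) (subst (λ t → S [ w ]≔ t ≡ S) w∈ ([]≔-lookup S w))

  anchor : Fin n → Fin n → Bool → Fin n
  anchor a b true  = a
  anchor a b false = b

  Copies : Colouring → Fin n → Fin n → List (Fin n × Bool) → Set
  Copies g a b = All (λ ws → lookup g (proj₁ ws) ≡ lookup g (anchor a b (proj₂ ws)))

  Determined : Colouring → Fin n → Fin n → List (Fin n × Bool) → Set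
  Determined g a b cs = Good g × Coloured g a × Coloured g b × Copies g a b cs

  opaque
    Determined? : ∀ g a b cs → Dec (Determined g a b cs)
    Determined? g a b cs = Good? g ×-dec (Coloured? g a ×-dec (Coloured? g b ×-dec
      All.all? (λ ws → lookup g (proj₁ ws) ≟ᶜ lookup g (anchor a b (proj₂ ws))) cs))

  module _ (g : Colouring) (w : Fin n) (a b : Fin n) (a≢w : a ≢ w) (b≢w : b ≢ w) where
    anchor≢w : ∀ s → anchor a b s ≢ w
    anchor≢w true  = a≢w
    anchor≢w false = b≢w

    Copies-unset : ∀ c cs → w ∉ map proj₁ cs → Copies (g [ w ]≔ just c) a b cs → Copies g a b cs
    Copies-unset c []             _  _         = []
    Copies-unset c ((u , s) ∷ cs) w∉ (e ∷ cps) =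
      trans (sym (lookup∘update′ (λ q → w∉ (here (sym q))) g (just c))) (trans e (lookup∘update′ (anchor≢w s) g (just c)))
      ∷ Copies-unset c cs (w∉ ∘ there) cps

    -- The colour of w is forced to be that of its anchor, so at most one c survives.
    ∑Fin-Determined : ∀ s cs → lookup g w ≡ nothing → w ∉ map proj₁ cs →
      ∑Fin N (λ c → 𝟙 (Determined? (g [ w ]≔ just c) a b ((w , s) ∷ cs))) ≤ 𝟙 (Determined? g a b cs)
    ∑Fin-Determined s cs gw≡nothing w∉ with Determined? g a b cs
    ... | yes _ = ∑Fin-𝟙≤1-just N (lookup g (anchor a b s)) (λ c → Determined? (g [ w ]≔ just c) a b ((w , s) ∷ cs))
          (λ c (_ , _ , _ , cps) →
            trans (sym (lookup∘update′ (anchor≢w s) g (just c))) (trans (sym (All.head cps)) (lookup∘update w g (just c))))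
    ... | no ¬det = ≤-reflexive (trans (∑Fin-cong N λ c → 𝟙-no (Determined? (g [ w ]≔ just c) a b ((w , s) ∷ cs))
            (λ (good , ca , cb , cps) → ¬det
              ( Good-⊑ {g} {g [ w ]≔ just c} (⊑-≔ g w c gw≡nothing) good
              , Coloured-unset g w c a≢w ca , Coloured-unset g w c b≢w cb , Copies-unset c cs w∉ (All.tail cps))))
          (∑Fin-0 N))

  -- Forgetting the colours of the copied vertices is injective on determined colourings.
  #Determined≤#Good∖ : ∀ cs S (a b : Fin n) → Distinct (a ∷ b ∷ map proj₁ cs) → All (_∈ˢ S) (map proj₁ cs) →
    ∑Col S (λ g → 𝟙 (Determined? g a b cs)) ≤ #Good (S ∖ map proj₁ cs)
  #Determined≤#Good∖ [] S a b _ _ = ∑Col-mono S (λ g _ → 𝟙-mono (Determined? g a b []) (Good? g) proj₁)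
  #Determined≤#Good∖ ((w , s) ∷ cs) S a b d (w∈ ∷ ws∈) = begin
      ∑Col S F
    ≡⟨ cong (λ T → ∑Col T F) (sym (≔-restore S w w∈)) ⟩
      ∑Col (S⁻ [ w ]≔ true) F
    ≡⟨ ∑Col-extend S⁻ w F (lookup∘update w S false) ⟩
      ∑Col S⁻ (λ g → ∑Fin N (λ c → F (g [ w ]≔ just c)))
    ≤⟨ ∑Col-mono S⁻ (λ g dom → ∑Fin-Determined g w a b a≢w b≢w s cs (Domain-∉ dom w (lookup∘update w S false)) w∉) ⟩
      ∑Col S⁻ (λ g → 𝟙 (Determined? g a b cs))
    ≤⟨ #Determined≤#Good∖ cs S⁻ a b d′ (∈ˢ-remove S w (map proj₁ cs) w∉ ws∈) ⟩
      #Good (S⁻ ∖ map proj₁ cs) ∎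
    where
    open ≤-Reasoning
    F : Colouring → ℕ
    F g = 𝟙 (Determined? g a b ((w , s) ∷ cs))
    S⁻ = S [ w ]≔ false
    a≢w : a ≢ w
    a≢w e = Distinct-head d (there (here e))
    b≢w : b ≢ w
    b≢w e = Distinct-head (Distinct-tail d) (here e)
    w∉ : w ∉ map proj₁ cs
    w∉ = Distinct-head (Distinct-tail (Distinct-tail d))
    d′ : Distinct (a ∷ b ∷ map proj₁ cs)
    d′ = Distinct-fewer (a ∷ b ∷ map proj₁ cs) (a ∷ b ∷ w ∷ map proj₁ cs)
           (λ y → +-monoʳ-≤ (𝟙 (y ≟ a)) (+-monoʳ-≤ (𝟙 (y ≟ b)) (m≤n+m _ (𝟙 (y ≟ w))))) d

module Counting {n : ℕ} (G : Graph n) (k Δ x m₁ : ℕ) (maxdeg : ∀ v → degree G v ≤ Δ) (k≥2 : 2 ≤ k)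
  (m≡1+m₁ : 2 * k ∸ 2 ≡ suc m₁) (x≥1 : 1 ≤ x)
  (x-large : k * (Δ * (Δ ∸ 1) ^ suc m₁) * suc m₁ ^ suc m₁ ≤ x ^ suc m₁ * m₁ ^ m₁) where
  open Sums
  open VertexLists n
  open PartialColourings (Δ + x)
  open GoodColourings G k (Δ + x)
  open NonBacktrackingWalks G Δ maxdeg
  open Arms k
  open Extension G k (Δ + x) Δ maxdeg k≥2
  open Peeling G k (Δ + x)
  open Arithmetic

  m₁≥1 : 1 ≤ m₁
  m₁≥1 = 1≤m₁ k m₁ k≥2 m≡1+m₁

  p q : ℕ
  p = x * m₁
  q = suc m₁

  Grows : Vec Bool n → Set
  Grows T = ∀ w → lookup T w ≡ false → p * #Good T ≤ q * #Good (T [ w ]≔ true)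

  Grows-below : Vec Bool n → Set
  Grows-below S = ∀ T → card T < card S → Grows T

  Grows-many : ∀ ws S → Grows-below S → Distinct ws → All (_∈ˢ S) ws →
    p ^ length ws * #Good (S ∖ ws) ≤ q ^ length ws * #Good S
  Grows-many []       S IH _ _          = ≤-refl
  Grows-many (w ∷ ws) S IH d (w∈ ∷ ws∈) = begin
      p * p ^ length ws * #Good (S⁻ ∖ ws)    ≡⟨ *-assoc p _ _ ⟩
      p * (p ^ length ws * #Good (S⁻ ∖ ws))  ≤⟨ *-monoʳ-≤ p (Grows-many ws S⁻ IH⁻ (Distinct-tail d) (∈ˢ-remove S w ws (Distinct-head d) ws∈)) ⟩
      p * (q ^ length ws * #Good S⁻)         ≡⟨ swap p (q ^ length ws) (#Good S⁻) ⟩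
      q ^ length ws * (p * #Good S⁻)         ≤⟨ *-monoʳ-≤ (q ^ length ws) (IH S⁻ S⁻<S w (lookup∘update w S false)) ⟩
      q ^ length ws * (q * #Good (S⁻ [ w ]≔ true))
                                             ≡⟨ cong (λ T → q ^ length ws * (q * #Good T)) (≔-restore S w w∈) ⟩
      q ^ length ws * (q * #Good S)          ≡⟨ regroup q (q ^ length ws) (#Good S) ⟩
      q * q ^ length ws * #Good S            ∎
    where
    open ≤-Reasoning
    S⁻ = S [ w ]≔ false
    S⁻<S : card S⁻ < card S
    S⁻<S = card-remove S w w∈
    IH⁻ : Grows-below S⁻
    IH⁻ T T<S⁻ = IH T (<-trans T<S⁻ S⁻<S)
    swap : ∀ a b c → a * (b * c) ≡ b * (a * c)
    swap = solve-∀
    regroup : ∀ a b c → b * (a * c) ≡ a * b * c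
    regroup = solve-∀

  alternate : Bool → List (Fin n) → List (Fin n × Bool)
  alternate s []       = []
  alternate s (y ∷ ys) = (y , s) ∷ alternate (not s) ys

  map-alternate : ∀ s ys → map proj₁ (alternate s ys) ≡ ys
  map-alternate s []       = refl
  map-alternate s (y ∷ ys) = cong (y ∷_) (map-alternate (not s) ys)

  Repeats⇒Copies : ∀ g a b s ys → Repeats g (anchor a b s) (anchor a b (not s)) ys → Copies g a b (alternate s ys)
  Repeats⇒Copies g a b s     []       _       = []
  Repeats⇒Copies g a b true  (y ∷ ys) (e , r) = e ∷ Repeats⇒Copies g a b false ys r
  Repeats⇒Copies g a b false (y ∷ ys) (e , r) = e ∷ Repeats⇒Copies g a b true ys r

  inner-vertices : ∀ (A : List (Fin n)) a b rs → length A + length (a ∷ b ∷ rs) ≡ 2 * k ∸ 1 → length (A ++ rs) ≡ m₁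
  inner-vertices A a b rs len = suc-injective (suc-injective (begin
      suc (suc (length (A ++ rs)))         ≡⟨ cong (2 +_) (length-++ A) ⟩
      suc (suc (length A + length rs))     ≡⟨ cong suc (sym (+-suc (length A) (length rs))) ⟩
      suc (length A + suc (length rs))     ≡⟨ sym (+-suc (length A) _) ⟩
      length A + length (a ∷ b ∷ rs)       ≡⟨ len ⟩
      2 * k ∸ 1                            ≡⟨ 2k∸1≡1+[2k∸2] k k≥2 ⟩
      suc (2 * k ∸ 2)                      ≡⟨ cong suc m≡1+m₁ ⟩
      suc (suc m₁)                         ∎))
    where open ≡-Reasoning

  -- A bad pattern on the arms A and a ∷ b ∷ rs is determined by its restriction to S ∖ (A ++ rs),
  -- and |A ++ rs| = m - 1 = m₁.
  #BadPattern≤ : ∀ S v → Grows-below S → ∀ A a b rs → ArmsIn S v A (a ∷ b ∷ rs) →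
    p ^ m₁ * ∑Col S (λ g → 𝟙 (BadPattern? S v g A (a ∷ b ∷ rs))) ≤ q ^ m₁ * #Good S
  #BadPattern≤ S v IH A a b rs (len , d , in-S) = begin
      p ^ m₁ * ∑Col S (λ g → 𝟙 (BadPattern? S v g A B))
    ≤⟨ *-monoʳ-≤ (p ^ m₁) (∑Col-mono S (λ g _ → 𝟙-mono (BadPattern? S v g A B) (Determined? g a b cs) determined)) ⟩
      p ^ m₁ * ∑Col S (λ g → 𝟙 (Determined? g a b cs))
    ≤⟨ *-monoʳ-≤ (p ^ m₁) (#Determined≤#Good∖ cs S a b (subst (λ t → Distinct (a ∷ b ∷ t)) (sym cs-vertices) ab-ws-distinct)
                                                      (subst (All (_∈ˢ S)) (sym cs-vertices) ws-in-S)) ⟩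
      p ^ m₁ * #Good (S ∖ map proj₁ cs)
    ≡⟨ cong₂ (λ e ws → p ^ e * #Good (S ∖ ws)) (sym ws-length) cs-vertices ⟩
      p ^ length ws * #Good (S ∖ ws)
    ≤⟨ Grows-many ws S IH (Distinct-tail (Distinct-tail ab-ws-distinct)) ws-in-S ⟩
      q ^ length ws * #Good S
    ≡⟨ cong (λ e → q ^ e * #Good S) ws-length ⟩
      q ^ m₁ * #Good S ∎
    where
    open ≤-Reasoning
    B = a ∷ b ∷ rs
    ws = A ++ rs
    cs = alternate true A ++ alternate true rs
    cs-vertices : map proj₁ cs ≡ ws
    cs-vertices = trans (map-++ proj₁ (alternate true A) (alternate true rs)) (cong₂ _++_ (map-alternate true A) (map-alternate true rs))
    determined : ∀ {g} → BadPattern S v g A B → Determined g a b cs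
    determined {g} (_ , good , ca , cb , rA , rrs) =
      good , ca , cb , All.++⁺ (Repeats⇒Copies g a b true A rA) (Repeats⇒Copies g a b true rs rrs)
    ab-ws-distinct : Distinct (a ∷ b ∷ ws)
    ab-ws-distinct = Distinct-fewer (a ∷ b ∷ ws) (v ∷ A ++ B) fewer d
      where
      fewer : ∀ y → occ y (a ∷ b ∷ ws) ≤ occ y (v ∷ A ++ B)
      fewer y = begin
          𝟙 (y ≟ a) + (𝟙 (y ≟ b) + occ y (A ++ rs))            ≡⟨ cong (λ t → 𝟙 (y ≟ a) + (𝟙 (y ≟ b) + t)) (occ-++ y A rs) ⟩
          𝟙 (y ≟ a) + (𝟙 (y ≟ b) + (occ y A + occ y rs))       ≡⟨ rotate (𝟙 (y ≟ a)) (𝟙 (y ≟ b)) (occ y A) (occ y rs) ⟩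
          occ y A + occ y B                                    ≤⟨ m≤n+m _ (𝟙 (y ≟ v)) ⟩
          𝟙 (y ≟ v) + (occ y A + occ y B)                      ≡⟨ cong (𝟙 (y ≟ v) +_) (sym (occ-++ y A B)) ⟩
          occ y (v ∷ A ++ B)                                   ∎
        where
        rotate : ∀ a b c r → a + (b + (c + r)) ≡ c + (a + (b + r))
        rotate = solve-∀
    ws-in-S : All (_∈ˢ S) ws
    ws-in-S = All.++⁺ (All.++⁻ˡ A in-S) (All.tail (All.tail (All.++⁻ʳ A in-S)))
    ws-length : length ws ≡ m₁
    ws-length = inner-vertices A a b rs len

  no-patterns : ∀ S v A B → (∀ g → ¬ BadPattern S v g A B) →
    p ^ m₁ * ∑Col S (λ g → 𝟙 (BadPattern? S v g A B)) ≤ q ^ m₁ * #Good S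
  no-patterns S v A B none =
    ≤-trans (≤-reflexive (trans (cong (p ^ m₁ *_) (∑Col-𝟙-none S (λ g → BadPattern? S v g A B) none)) (*-zeroʳ (p ^ m₁)))) z≤n

  #BadPattern≤-all : ∀ S v → Grows-below S → ∀ A B →
    p ^ m₁ * ∑Col S (λ g → 𝟙 (BadPattern? S v g A B)) ≤ q ^ m₁ * #Good S
  #BadPattern≤-all S v IH A []           = no-patterns S v A [] λ { g (_ , _ , ()) }
  #BadPattern≤-all S v IH A (a ∷ [])     = no-patterns S v A (a ∷ []) λ { g (_ , _ , ()) }
  #BadPattern≤-all S v IH A (a ∷ b ∷ rs) with ArmsIn? S v A (a ∷ b ∷ rs)
  ... | yes arms = #BadPattern≤ S v IH A a b rs arms
  ... | no ¬arms = no-patterns S v A (a ∷ b ∷ rs) (λ g bad → ¬arms (proj₁ bad))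

  Grows-step : ∀ S → Grows-below S → Grows S
  Grows-step S IH v v∉S =
    extension-step x Δ (#Good S) (#Good (S [ v ]≔ true)) bad A m₁ (extension-count S v v∉S) bad-bound x-large x≥1 m₁≥1
    where
    A = k * (Δ * (Δ ∸ 1) ^ suc m₁)
    patterns : List (Fin n) → List (Fin n) → ℕ
    patterns A B = ∑Col S (λ g → 𝟙 (BadPattern? S v g A B))
    bad = ∑Arms v patterns
    bad-bound : p ^ m₁ * bad ≤ A * (q ^ m₁ * #Good S)
    bad-bound = begin
        p ^ m₁ * ∑Arms v patterns                         ≤⟨ *-∑Arms (p ^ m₁) v patterns ⟩
        ∑Arms v (λ A B → p ^ m₁ * patterns A B)           ≤⟨ ∑Arms-≤ v (#BadPattern≤-all S v IH) ⟩
        k * (Δ * ((Δ ∸ 1) ^ m * (q ^ m₁ * #Good S)))      ≡⟨ cong (λ e → k * (Δ * ((Δ ∸ 1) ^ e * (q ^ m₁ * #Good S)))) m≡1+m₁ ⟩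
        k * (Δ * ((Δ ∸ 1) ^ suc m₁ * (q ^ m₁ * #Good S))) ≡⟨ regroup k Δ ((Δ ∸ 1) ^ suc m₁) (q ^ m₁ * #Good S) ⟩
        A * (q ^ m₁ * #Good S)                            ∎
      where
      open ≤-Reasoning
      regroup : ∀ k Δ D M → k * (Δ * (D * M)) ≡ k * (Δ * D) * M
      regroup = solve-∀

  Grows-bounded : ∀ b S → card S < b → Grows S
  Grows-bounded (suc b) S S<b = Grows-step S (λ T T<S → Grows-bounded b T (≤-trans T<S (≤-pred S<b)))

  good-total-colouring : ∃ λ g → Domain (replicate n true) g × Good g
  good-total-colouring with ∑Col-positive (replicate n true) (𝟙 ∘ Good?) #Good-full-positive
    where
    vertices : List (Fin n)
    vertices = tabulate (λ u → u)
    full = replicate n true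
    grown : p ^ length vertices * #Good (full ∖ vertices) ≤ q ^ length vertices * #Good full
    grown = Grows-many vertices full (λ T _ → Grows-bounded (suc (card T)) T ≤-refl) (tabulate-Distinct (λ u → u) (λ e → e))
              (All.universal (λ u → lookup-replicate u true) vertices)
    #Good-empty : #Good (full ∖ vertices) ≡ 1
    #Good-empty = begin
        #Good (full ∖ vertices)           ≡⟨ cong #Good (all-false (full ∖ vertices) (λ u → ∖-removes vertices full u (∈-tabulate⁺ u))) ⟩
        #Good (replicate n false)         ≡⟨ ∑Col-empty (𝟙 ∘ Good?) ⟩
        𝟙 (Good? (replicate n nothing))   ≡⟨ 𝟙-yes (Good? (replicate n nothing)) (Good-empty (≤-trans (s≤s z≤n) k≥2)) ⟩
        1                                 ∎
      where open ≡-Reasoning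
    #Good-full-positive : 1 ≤ #Good full
    #Good-full-positive with #Good full in e
    ... | zero = ⊥-elim (1+n≰n {0} (begin
        1                                      ≤⟨ ^-positive p (length vertices) (*-mono-≤ x≥1 m₁≥1) ⟩
        p ^ length vertices                    ≡⟨ sym (*-identityʳ _) ⟩
        p ^ length vertices * 1                ≡⟨ cong (p ^ length vertices *_) (sym #Good-empty) ⟩
        p ^ length vertices * #Good (full ∖ vertices)
                                               ≤⟨ grown ⟩
        q ^ length vertices * #Good full       ≡⟨ cong (q ^ length vertices *_) e ⟩
        q ^ length vertices * 0                ≡⟨ *-zeroʳ (q ^ length vertices) ⟩
        0                                      ∎))
      where open ≤-Reasoning
    ... | suc _ = s≤s z≤n
  ... | g , dom , good = g , dom , 𝟙-witness (Good? g) good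

within-bound : ∀ k Δ x m₁ → 2 * k ∸ 2 ≡ suc m₁ →
  x ^ suc m₁ * m₁ ^ m₁ ≤ suc m₁ ^ suc m₁ * k * Δ ^ (suc m₁ + 1) → WithinBound k Δ (Δ + x)
within-bound k Δ x m₁ m≡1+m₁ small rewrite m+n∸m≡n Δ x | m≡1+m₁ = inj₂ small

theorem10 : (k : ℕ) → 2 ≤ k → (n : ℕ) → (G : Graph n) → (Δ : ℕ) → MaxDegree G Δ → 1 ≤ Δ →
    Σ ℕ λ c → Σ (Fin n → Fin c) λ f → StarKColoring k G f × WithinBound k Δ c
theorem10 k k≥2 n G Δ (maxdeg , _) Δ≥1 =
  let m₁ = 2 * k ∸ 3
      m≡1+m₁ = Arithmetic.2k∸2≡1+[2k∸3] k k≥2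
      x , x≥1 , x-small , x-large = Arithmetic.palette-excess m₁ k Δ (Arithmetic.1≤m₁ k m₁ k≥2 m≡1+m₁) (≤-trans (s≤s z≤n) k≥2) Δ≥1
      g , dom , good = Counting.good-total-colouring G k Δ x m₁ maxdeg k≥2 m≡1+m₁ x≥1 x-large
  in Δ + x , PartialColourings.totalise (Δ + x) dom ,
     GoodColourings.Good⇒StarKColoring G k (Δ + x) dom good , within-bound k Δ x m₁ m≡1+m₁ x-small
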